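{- Let $p$ be a prime with $p\equiv 3\pmod 4$ and let $\mathbb{F}_p$ be the field with $p$ elements. For $K\in\mathbb{F}_p$ let $C_K=\{(u,v)\in\mathbb{F}_p^2: u^2+v^2=K\}$. Let $U_1,U_2,\dots$ be i.i.d. uniformly distributed on $C_1$, and let $X_0=(0,0)$, $X_n=U_1+\cdots+U_n$. Write $c_1^n=\sum_{j=0}^{p-1}\alpha_{n,j}c_j$ with $\alpha_{n,j}=\Pr(X_n\in C_j)$. Then $$\lim_{n\to\infty} c_1^n=\frac{1}{p^2}c_0+\frac{p+1}{p^2}(c_1+c_2+\cdots+c_{p-1}),$$ i.e. $\lim_{n\to\infty}\alpha_{n,0}=\frac1{p^2}$ and $\lim_{n\to\infty}\alpha_{n,j}=\frac{p+1}{p^2}$ for $j=1,\dots,p-1$. Equivalently, for the Markov chain on the set of circles $\{c_0,\dots,c_{p-1}\}$ with transition kernel $K(c_i,c_j)=n_{i1}^j$, one has $K^n(c_i,c_j)\to\pi(c_j)$ for all $i,j$, where $\pi(c_0)=1/p^2$ and $\pi(c_j)=(p+1)/p^2$ for $j\neq 0$.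
   Context: Here $n_{ij}^k=N_{ij}^k/(|C_i||C_j|)$ with $N_{ij}^k=\#\{(a,b)\in C_i\times C_j: a+b\in C_k\}$; $n_{i1}^j$ is the probability that a point uniformly distributed on $C_i$, translated by a uniform point of $C_1$, lands on $C_j$. $c_j$ is a formal symbol for the circle $C_j$. -}

module Defs where

open import Data.Nat using (ℕ; zero; suc; _+_; _*_; _^_; _%_; _≤_; NonZero)
open import Data.Nat.Properties using (_≟_)
open import Data.Product using (_×_; _,_; ∃-syntax)
open import Data.List using (List; []; _∷_; [_]; map; concatMap; filter; length; upTo; foldr)
open import Data.Integer using (+_)
open import Data.Rational using (ℚ; 0ℚ; _/_; _-_; ∣_∣; _<_)

-- points of F_p^2, coordinates represented by naturals 0..p-1
Pt : Set
Pt = ℕ × ℕ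

points : ℕ → List Pt
points p = concatMap (λ u → map (λ v → (u , v)) (upTo p)) (upTo p)

module _ (p : ℕ) .{{_ : NonZero p}} where

  norm : Pt → ℕ
  norm (u , v) = (u * u + v * v) % p

  circle : ℕ → List Pt
  circle K = filter (λ x → norm x ≟ K) (points p)

  -- all n-tuples (U_1,...,U_n) of points of C_1 (equally likely outcomes)
  tuples : ℕ → List (List Pt)
  tuples zero = [ [] ]
  tuples (suc n) = concatMap (λ u → map (u ∷_) (tuples n)) (circle 1)

  walkSum : List Pt → Pt
  walkSum us = foldr (λ { (a , b) (c , d) → ((a + c) % p , (b + d) % p) }) (0 , 0) us

  hits : ℕ → ℕ → ℕ
  hits n j = length (filter (λ t → norm (walkSum t) ≟ j) (tuples n))

-- a / d as a rational (d = 0 never occurs in our use)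
frac : ℕ → ℕ → ℚ
frac a zero = 0ℚ
frac a (suc d) = (+ a) / suc d

α : (p : ℕ) .{{_ : NonZero p}} → ℕ → ℕ → ℚ
α p n j = frac (hits p n j) (length (circle p 1) ^ n)

_⟶_ : (ℕ → ℚ) → ℚ → Set
a ⟶ L = ∀ (ε : ℚ) → 0ℚ < ε → ∃[ N ] (∀ n → N ≤ n → ∣ a n - L ∣ < ε)

-- α_{n,j} counts the step sequences in C_1ⁿ whose sum lies on C_j, divided by |C_1|ⁿ, so it equals
-- Tⁿ 𝟙_{C_j} (0) / qⁿ for the operator T f (x) = ∑_{u ∈ C_1} f (u + x) and q = |C_1|.  With the steps
-- (1,0), (−1,0), (0,1) and, p being odd, the loop of p steps (1,0), every point reaches every other in
-- exactly M = 5p steps, so all entries of the M-step kernel are at least 1.  This Doeblin bound shrinks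
-- the oscillation of Tⁿ f by the factor (q^M − p²)/q^M every M steps while the total mass is qⁿ ∑ f,
-- hence Tⁿ f (0) / qⁿ → ∑ f / p², i.e. α_{n,j} → |C_j| / p².  The circles are counted in F_p: −1 is
-- not a square as p ≡ 3 (mod 4), so C_0 = {0}; every K is a sum a² + b² of two squares (pigeonhole),
-- and multiplication by the Gaussian integer a + bi maps C_1 onto C_K; as ∑_K |C_K| = p², this forces
-- |C_K| = p + 1 for K ≠ 0.

module Submission where

open import Defs
import Algebra.Properties.CommutativeSemigroup as CommutativeSemigroup
open import Data.Empty using (⊥-elim)
open import Data.Fin using (Fin; toℕ; fromℕ<; splitAt; join)
import Data.Fin.Properties as Fin
import Data.Integer as ℤ
open import Data.Integer.DivMod using (a≡a%ℕn+[a/ℕn]*n; n%ℕd<d)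
open import Data.Integer.Divisibility.Signed using (_∣_; divides; ∣m∣n⇒∣m+n; ∣m⇒∣-m; ∣m⇒∣m*n; ∣n⇒∣m*n; ∣⇒∣ᵤ; ∣ᵤ⇒∣)
import Data.Integer.Properties as ℤ
open import Data.Integer.Tactic.RingSolver using (solve-∀)
open import Data.List using (List; []; _∷_; [_]; _++_; map; filter; length; concatMap; applyUpTo; upTo; cartesianProduct)
open import Data.List.Membership.Propositional using (_∈_)
open import Data.List.Membership.Propositional.Properties
  using (∈-length; ∈-map⁺; ∈-map⁻; ∈-filter⁺; ∈-filter⁻; ∈-applyUpTo⁺; ∈-applyUpTo⁻; ∈-upTo⁺; ∈-upTo⁻;
         ∈-cartesianProduct⁺; ∈-cartesianProduct⁻)
open import Data.List.Membership.Propositional.Properties.WithK using (unique∧set⇒bag)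
open import Data.List.Properties using (map-∘; map-++; length-++; length-map; length-upTo; length-applyUpTo)
open import Data.List.Relation.Binary.BagAndSetEquality using (∼bag⇒↭)
open import Data.List.Relation.Binary.Permutation.Propositional using (_↭_)
import Data.List.Relation.Binary.Permutation.Propositional.Properties as ↭
import Data.List.Relation.Unary.All as All
import Data.List.Relation.Unary.All.Properties as All
import Data.List.Relation.Unary.AllPairs as AllPairs
open import Data.List.Relation.Unary.Any using (here; there)
open import Data.List.Relation.Unary.Unique.Propositional using (Unique)
import Data.List.Relation.Unary.Unique.Propositional.Properties as Unique
import Data.Nat as ℕ
open import Data.Nat using (ℕ; zero; suc; NonZero; _≤_; _<_; z≤n; s≤s)
open import Data.Nat.Coprimality using (prime⇒coprime; coprime-Bézout)
open import Data.Nat.Divisibility as ℕ using (>⇒∤)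
open import Data.Nat.DivMod
  using (m≡m%n+[m/n]*n; m%n<n; m<n⇒m%n≡m; m%n%n≡m%n; %-distribˡ-+; [m+n]%n≡m%n; [m+kn]%n≡m%n; m*n/n≡m; /-monoˡ-≤)
open import Data.Nat.GCD using (module Bézout)
open import Data.Nat.ListAction using (sum; product)
open import Data.Nat.ListAction.Properties using (sum-++; sum-↭; product-↭)
open import Data.Nat.Primality using (Prime; euclidsLemma; prime⇒nonZero; prime⇒nonTrivial)
import Data.Nat.Properties as ℕ
import Data.Nat.Tactic.RingSolver as ℕ-Solver
open import Data.Product using (_×_; _,_; proj₁; proj₂; ∃-syntax; ∃₂; uncurry)
open import Data.Product.Properties using (≡-dec)
import Data.Rational as ℚ
import Data.Rational.Properties as ℚ
import Data.Rational.Unnormalised as ℚᵘ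
import Data.Rational.Unnormalised.Properties as ℚᵘ
open import Data.Sum using (_⊎_; inj₁; inj₂; [_,_]′)
open import Function using (_∘_; mk⇔; Injective)
open import Relation.Binary using (IsEquivalence; Setoid; DecidableEquality)
open import Relation.Binary.PropositionalEquality hiding ([_])
import Relation.Binary.Reasoning.Setoid as SetoidReasoning
open import Relation.Nullary using (¬_; Dec; yes; no)
open import Relation.Unary using (Pred; Decidable)

module ListSums where

  open import Data.Nat using (_+_; _*_)
  open CommutativeSemigroup ℕ.+-commutativeSemigroup using (interchange)

  private variable
    A B : Set
    xs ys : List A

  Unique-map⁺ : {f : A → B} → (∀ {x y} → x ∈ xs → y ∈ xs → f x ≡ f y → x ≡ y) →
                Unique xs → Unique (map f xs)
  Unique-map⁺ {xs = []} inj AllPairs.[] = AllPairs.[]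
  Unique-map⁺ {xs = x ∷ xs} inj (x∉xs AllPairs.∷ xs!) =
    All.map⁺ (All.tabulate λ y∈xs fx≡fy → All.lookup x∉xs y∈xs (inj (here refl) (there y∈xs) fx≡fy))
    AllPairs.∷ Unique-map⁺ (λ x∈ y∈ → inj (there x∈) (there y∈)) xs!

  map-↭ : {f : A → B} (g : B → A) → Unique xs → Unique ys →
          (∀ {x} → x ∈ xs → f x ∈ ys) → (∀ {y} → y ∈ ys → g y ∈ xs) →
          (∀ {x} → x ∈ xs → g (f x) ≡ x) → (∀ {y} → y ∈ ys → f (g y) ≡ y) →
          map f xs ↭ ys
  map-↭ {xs = xs} {ys = ys} {f = f} g xs! ys! f∈ g∈ gf fg =
    ∼bag⇒↭ (unique∧set⇒bag (Unique-map⁺ f-injective xs!) ys! (mk⇔ to from))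
    where
    f-injective : ∀ {x y} → x ∈ xs → y ∈ xs → f x ≡ f y → x ≡ y
    f-injective x∈ y∈ fx≡fy = trans (sym (gf x∈)) (trans (cong g fx≡fy) (gf y∈))
    to : ∀ {z} → z ∈ map f xs → z ∈ ys
    to z∈ with ∈-map⁻ f z∈
    ... | x , x∈ , refl = f∈ x∈
    from : ∀ {z} → z ∈ ys → z ∈ map f xs
    from z∈ = subst (_∈ map f xs) (fg z∈) (∈-map⁺ f (g∈ z∈))

  length≡1 : ∀ {x} → Unique xs → x ∈ xs → (∀ {y} → y ∈ xs → y ≡ x) → length xs ≡ 1
  length≡1 {xs = _ ∷ []} _ _ _ = refl
  length≡1 {xs = _ ∷ _ ∷ _} ((y≢z All.∷ _) AllPairs.∷ _) _ only-x =
    ⊥-elim (y≢z (trans (only-x (here refl)) (sym (only-x (there (here refl))))))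

  ∑ : List A → (A → ℕ) → ℕ
  ∑ xs f = sum (map f xs)

  indicator : {P : Set} → Dec P → ℕ
  indicator (yes _) = 1
  indicator (no _) = 0

  module _ {f g : A → ℕ} where

    ∑-cong : (∀ {x} → x ∈ xs → f x ≡ g x) → ∑ xs f ≡ ∑ xs g
    ∑-cong {xs = []} eq = refl
    ∑-cong {xs = x ∷ xs} eq = cong₂ _+_ (eq (here refl)) (∑-cong (eq ∘ there))

    ∑-mono : (∀ {x} → x ∈ xs → f x ≤ g x) → ∑ xs f ≤ ∑ xs g
    ∑-mono {xs = []} le = ℕ.≤-refl
    ∑-mono {xs = x ∷ xs} le = ℕ.+-mono-≤ (le (here refl)) (∑-mono (le ∘ there))

    ∑-+ : ∀ xs → ∑ xs (λ x → f x + g x) ≡ ∑ xs f + ∑ xs g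
    ∑-+ [] = refl
    ∑-+ (x ∷ xs) = trans (cong (f x + g x +_) (∑-+ xs)) (interchange (f x) (g x) (∑ xs f) (∑ xs g))

  ∑-*ˡ : ∀ c (f : A → ℕ) xs → ∑ xs (λ x → c * f x) ≡ c * ∑ xs f
  ∑-*ˡ c f [] = sym (ℕ.*-zeroʳ c)
  ∑-*ˡ c f (x ∷ xs) = trans (cong (c * f x +_) (∑-*ˡ c f xs)) (sym (ℕ.*-distribˡ-+ c (f x) (∑ xs f)))

  ∑-*ʳ : ∀ c (f : A → ℕ) xs → ∑ xs (λ x → f x * c) ≡ ∑ xs f * c
  ∑-*ʳ c f xs = trans (∑-cong {xs = xs} (λ {x} _ → ℕ.*-comm (f x) c)) (trans (∑-*ˡ c f xs) (ℕ.*-comm c (∑ xs f)))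

  ∑-const : ∀ c (xs : List A) → ∑ xs (λ _ → c) ≡ length xs * c
  ∑-const c [] = refl
  ∑-const c (x ∷ xs) = cong (c +_) (∑-const c xs)

  ∑-zero : {f : A → ℕ} → (∀ {x} → x ∈ xs → f x ≡ 0) → ∑ xs f ≡ 0
  ∑-zero {xs = xs} f≡0 = trans (∑-cong f≡0) (trans (∑-const 0 xs) (ℕ.*-zeroʳ (length xs)))

  ∑-single : {f : A → ℕ} {x : A} → x ∈ xs → f x ≤ ∑ xs f
  ∑-single {xs = y ∷ xs} {f} (here refl) = ℕ.m≤m+n (f y) (∑ xs f)
  ∑-single {xs = y ∷ xs} {f} (there x∈) = ℕ.≤-trans (∑-single x∈) (ℕ.m≤n+m (∑ xs f) (f y))

  ∑-swap : (F : A → B → ℕ) (xs : List A) (ys : List B) →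
           ∑ xs (λ x → ∑ ys (F x)) ≡ ∑ ys (λ y → ∑ xs (λ x → F x y))
  ∑-swap F [] ys = sym (∑-zero {xs = ys} (λ _ → refl))
  ∑-swap F (x ∷ xs) ys = trans (cong (∑ ys (F x) +_) (∑-swap F xs ys)) (sym (∑-+ ys))

  ∑-map : (f : B → ℕ) (g : A → B) (xs : List A) → ∑ (map g xs) f ≡ ∑ xs (f ∘ g)
  ∑-map f g xs = cong sum (sym (map-∘ xs))

  ∑-concatMap : (f : B → ℕ) (g : A → List B) (xs : List A) → ∑ (concatMap g xs) f ≡ ∑ xs (λ x → ∑ (g x) f)
  ∑-concatMap f g [] = refl
  ∑-concatMap f g (x ∷ xs) = trans (cong sum (map-++ f (g x) (concatMap g xs)))
    (trans (sum-++ (map f (g x)) _) (cong (∑ (g x) f +_) (∑-concatMap f g xs)))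

  ∑-↭ : {f : A → ℕ} → xs ↭ ys → ∑ xs f ≡ ∑ ys f
  ∑-↭ {f = f} π = sum-↭ (↭.map⁺ f π)

  ∑-bijection : {f : B → ℕ} {σ : A → B} (τ : B → A) → Unique xs → Unique ys →
                (∀ {x} → x ∈ xs → σ x ∈ ys) → (∀ {y} → y ∈ ys → τ y ∈ xs) →
                (∀ {x} → x ∈ xs → τ (σ x) ≡ x) → (∀ {y} → y ∈ ys → σ (τ y) ≡ y) →
                ∑ xs (f ∘ σ) ≡ ∑ ys f
  ∑-bijection {xs = xs} {f = f} {σ} τ xs! ys! σ∈ τ∈ τσ στ =
    trans (sym (∑-map f σ xs)) (∑-↭ (map-↭ τ xs! ys! σ∈ τ∈ τσ στ))

  length-filter : {P : Pred A _} (P? : Decidable P) (xs : List A) → length (filter P? xs) ≡ ∑ xs (indicator ∘ P?)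
  length-filter P? [] = refl
  length-filter P? (x ∷ xs) with P? x
  ... | yes _ = cong suc (length-filter P? xs)
  ... | no _ = length-filter P? xs

  module _ (_≟_ : DecidableEquality A) where

    ∑-indicator : {h : A → ℕ} {x : A} → Unique xs → x ∈ xs → ∑ xs (λ z → indicator (x ≟ z) * h z) ≡ h x
    ∑-indicator {xs = z ∷ xs} {h} {x} (z∉xs AllPairs.∷ xs!) (here refl) with x ≟ x
    ... | no x≢x = ⊥-elim (x≢x refl)
    ... | yes _ = trans (cong₂ _+_ (ℕ.*-identityˡ (h x)) (∑-zero vanish)) (ℕ.+-identityʳ (h x))
      where
      vanish : ∀ {y} → y ∈ xs → indicator (x ≟ y) * h y ≡ 0
      vanish {y} y∈ with x ≟ y
      ... | yes refl = ⊥-elim (All.lookup z∉xs y∈ refl)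
      ... | no _ = refl
    ∑-indicator {xs = z ∷ xs} {x = x} (z∉xs AllPairs.∷ xs!) (there x∈) with x ≟ z
    ... | yes refl = ⊥-elim (All.lookup z∉xs x∈ refl)
    ... | no _ = ∑-indicator xs! x∈

    length-fibres : (f : B → A) (xs : List B) {ks : List A} → Unique ks → (∀ {x} → x ∈ xs → f x ∈ ks) →
                    length xs ≡ ∑ ks (λ k → length (filter (λ x → f x ≟ k) xs))
    length-fibres f xs {ks} ks! f∈ = begin
      length xs                                          ≡⟨ sym (trans (∑-const 1 xs) (ℕ.*-identityʳ _)) ⟩
      ∑ xs (λ _ → 1)                                     ≡⟨ sym (∑-cong {xs = xs} (λ x∈ → ∑-indicator ks! (f∈ x∈))) ⟩
      ∑ xs (λ x → ∑ ks (λ k → indicator (f x ≟ k) * 1))  ≡⟨ ∑-swap _ xs ks ⟩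
      ∑ ks (λ k → ∑ xs (λ x → indicator (f x ≟ k) * 1))  ≡⟨ ∑-cong {xs = ks} (λ _ → ∑-cong {xs = xs} (λ _ → ℕ.*-identityʳ _)) ⟩
      ∑ ks (λ k → ∑ xs (λ x → indicator (f x ≟ k)))      ≡⟨ sym (∑-cong {xs = ks} (λ {k} _ → length-filter (λ x → f x ≟ k) xs)) ⟩
      ∑ ks (λ k → length (filter (λ x → f x ≟ k) xs))    ∎
      where open ≡-Reasoning

open ListSums

module Counting where

  open import Data.Nat using (_+_; _*_)

  splitAt-injective : ∀ m {n} {i j : Fin (m + n)} → splitAt m i ≡ splitAt m j → i ≡ j
  splitAt-injective m {n} {i} {j} eq = trans (sym (Fin.join-splitAt m n i)) (trans (cong (join m n) eq) (Fin.join-splitAt m n j))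

  pigeonhole-two-families : ∀ {m n} → m < n + n → (f g : Fin n → Fin m) →
                            Injective _≡_ _≡_ f → Injective _≡_ _≡_ g → ∃₂ λ i j → f i ≡ g j
  pigeonhole-two-families {m} {n} m<2n f g f-inj g-inj
    with Fin.pigeonhole m<2n ([ f , g ]′ ∘ splitAt n)
  ... | i , j , i<j , same with splitAt n i in eqi | splitAt n j in eqj
  ...   | inj₁ a | inj₁ b = ⊥-elim (Fin.<⇒≢ i<j (splitAt-injective n (trans eqi (trans (cong inj₁ (f-inj same)) (sym eqj)))))
  ...   | inj₂ a | inj₂ b = ⊥-elim (Fin.<⇒≢ i<j (splitAt-injective n (trans eqi (trans (cong inj₂ (g-inj same)) (sym eqj)))))
  ...   | inj₁ a | inj₂ b = a , b , same
  ...   | inj₂ a | inj₁ b = b , a , sym same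

  concatMap-map≡cartesianProduct : {A B : Set} (xs : List A) (ys : List B) →
    concatMap (λ u → map (λ v → (u , v)) ys) xs ≡ cartesianProduct xs ys
  concatMap-map≡cartesianProduct [] ys = refl
  concatMap-map≡cartesianProduct (x ∷ xs) ys = cong (map (x ,_) ys ++_) (concatMap-map≡cartesianProduct xs ys)

  length-cartesianProduct : {A B : Set} (xs : List A) (ys : List B) → length (cartesianProduct xs ys) ≡ length xs * length ys
  length-cartesianProduct [] ys = refl
  length-cartesianProduct (x ∷ xs) ys =
    trans (length-++ (map (x ,_) ys)) (cong₂ _+_ (length-map (x ,_) ys) (length-cartesianProduct xs ys))

open Counting

module NatArithmetic where

  open import Data.Nat using (_+_; _*_; _^_; _%_)

  %4≡3⇒ : ∀ {n} → n % 4 ≡ 3 → ∃[ k ] n ≡ 3 + k * 4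
  %4≡3⇒ {n} n%4≡3 = n ℕ./ 4 , trans (m≡m%n+[m/n]*n n 4) (cong (_+ n ℕ./ 4 * 4) n%4≡3)

  %4≡3⇒odd : ∀ {n} → n % 4 ≡ 3 → ∃[ h ] n ≡ suc (h + h)
  %4≡3⇒odd {n} n%4≡3 = let k , n≡3+4k = %4≡3⇒ n%4≡3 in suc (2 * k) , trans n≡3+4k (identity k)
    where
    identity : ∀ k → 3 + k * 4 ≡ suc (suc (2 * k) + suc (2 * k))
    identity = ℕ-Solver.solve-∀

  m*m≡1+[m∸1]*c⇒c≡1+m : ∀ {m c} → 1 < m → m * m ≡ 1 + (m ℕ.∸ 1) * c → c ≡ suc m
  m*m≡1+[m∸1]*c⇒c≡1+m {suc zero} (s≤s ()) eq
  m*m≡1+[m∸1]*c⇒c≡1+m {suc r@(suc _)} {c} _ eq =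
    ℕ.*-cancelˡ-≡ c (suc (suc r)) r (ℕ.+-cancelˡ-≡ 1 _ _ (trans (sym eq) (identity r)))
    where
    identity : ∀ r → suc r * suc r ≡ 1 + r * suc (suc r)
    identity = ℕ-Solver.solve-∀

  even-or-odd : ∀ n → (∃[ j ] n ≡ j * 2) ⊎ (∃[ j ] n ≡ suc (j * 2))
  even-or-odd zero = inj₁ (0 , refl)
  even-or-odd (suc n) with even-or-odd n
  ... | inj₁ (j , refl) = inj₂ (j , refl)
  ... | inj₂ (j , refl) = inj₁ (suc j , refl)

  product-map-*ˡ : ∀ a (ns : List ℕ) → product (map (a *_) ns) ≡ a ^ length ns * product ns
  product-map-*ˡ a [] = refl
  product-map-*ˡ a (n ∷ ns) = trans (cong (a * n *_) (product-map-*ˡ a ns)) (interchange a n (a ^ length ns) (product ns))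
    where open CommutativeSemigroup ℕ.*-commutativeSemigroup using (interchange)

  ∣∧<⇒≡0 : ∀ {m n} → m ℕ.∣ n → n < m → n ≡ 0
  ∣∧<⇒≡0 {n = zero} _ _ = refl
  ∣∧<⇒≡0 {n = suc n} m∣n n<m = ⊥-elim (>⇒∤ n<m m∣n)

  [m%n+o]%n≡[m+o]%n : ∀ m n o .{{_ : NonZero n}} → (m % n + o) % n ≡ (m + o) % n
  [m%n+o]%n≡[m+o]%n m n o = begin
    (m % n + o) % n             ≡⟨ %-distribˡ-+ (m % n) o n ⟩
    (m % n % n + o % n) % n     ≡⟨ cong (λ t → (t + o % n) % n) (m%n%n≡m%n m n) ⟩
    (m % n + o % n) % n         ≡⟨ sym (%-distribˡ-+ m o n) ⟩
    (m + o) % n                 ∎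
    where open ≡-Reasoning

open NatArithmetic

module Congruence (p : ℕ) where

  open import Data.Integer using (ℤ; +_; 0ℤ; 1ℤ; _+_; _*_; -_; _-_; _^_; _%ℕ_; _/ℕ_; ∣_∣)

  infix 4 _≈_
  record _≈_ (x y : ℤ) : Set where
    constructor mk≈
    field divides-difference : + p ∣ x - y

  private
    divides⇒≈ : ∀ {x z w} → + p ∣ x → x ≡ z - w → z ≈ w
    divides⇒≈ d refl = mk≈ d

  ≈-reflexive : ∀ {x y} → x ≡ y → x ≈ y
  ≈-reflexive {x} refl = mk≈ (divides 0ℤ (ℤ.+-inverseʳ x))

  ≈-refl : ∀ {x} → x ≈ x
  ≈-refl = ≈-reflexive refl

  ≈-sym : ∀ {x y} → x ≈ y → y ≈ x
  ≈-sym {x} {y} (mk≈ d) = divides⇒≈ (∣m⇒∣-m d) (identity x y)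
    where
    identity : ∀ x y → - (x - y) ≡ y - x
    identity = solve-∀

  ≈-trans : ∀ {x y z} → x ≈ y → y ≈ z → x ≈ z
  ≈-trans {x} {y} {z} (mk≈ d) (mk≈ e) = divides⇒≈ (∣m∣n⇒∣m+n d e) (identity x y z)
    where
    identity : ∀ x y z → (x - y) + (y - z) ≡ x - z
    identity = solve-∀

  ≈-isEquivalence : IsEquivalence _≈_
  ≈-isEquivalence = record { refl = ≈-refl ; sym = ≈-sym ; trans = ≈-trans }

  ≈-setoid : Setoid _ _
  ≈-setoid = record { isEquivalence = ≈-isEquivalence }

  module ≈-Reasoning = SetoidReasoning ≈-setoid

  +-cong : ∀ {x x′ y y′} → x ≈ x′ → y ≈ y′ → x + y ≈ x′ + y′
  +-cong {x} {x′} {y} {y′} (mk≈ d) (mk≈ e) = divides⇒≈ (∣m∣n⇒∣m+n d e) (identity x x′ y y′)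
    where
    identity : ∀ x x′ y y′ → (x - x′) + (y - y′) ≡ (x + y) - (x′ + y′)
    identity = solve-∀

  *-cong : ∀ {x x′ y y′} → x ≈ x′ → y ≈ y′ → x * y ≈ x′ * y′
  *-cong {x} {x′} {y} {y′} (mk≈ d) (mk≈ e) =
    divides⇒≈ (∣m∣n⇒∣m+n (∣m⇒∣m*n y d) (∣n⇒∣m*n x′ e)) (identity x x′ y y′)
    where
    identity : ∀ x x′ y y′ → (x - x′) * y + x′ * (y - y′) ≡ x * y - x′ * y′
    identity = solve-∀

  -‿cong : ∀ {x y} → x ≈ y → - x ≈ - y
  -‿cong {x} {y} (mk≈ d) = divides⇒≈ (∣m⇒∣-m d) (identity x y)
    where
    identity : ∀ x y → - (x - y) ≡ - x - - y
    identity = solve-∀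

  ^-cong : ∀ {x y} n → x ≈ y → x ^ n ≈ y ^ n
  ^-cong zero d = ≈-refl
  ^-cong (suc n) d = *-cong d (^-cong n d)

  ≈0⇒∣ : ∀ {x} → x ≈ 0ℤ → + p ∣ x
  ≈0⇒∣ {x} (mk≈ d) = subst (+ p ∣_) (ℤ.+-identityʳ x) d

  ∣⇒≈0 : ∀ {x} → + p ∣ x → x ≈ 0ℤ
  ∣⇒≈0 {x} d = divides⇒≈ d (sym (ℤ.+-identityʳ x))

  x≈y⇒x-y≈0 : ∀ {x y} → x ≈ y → x - y ≈ 0ℤ
  x≈y⇒x-y≈0 (mk≈ d) = ∣⇒≈0 d

  x-y≈0⇒x≈y : ∀ {x y} → x - y ≈ 0ℤ → x ≈ y
  x-y≈0⇒x≈y d = mk≈ (≈0⇒∣ d)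

  module _ .{{_ : NonZero p}} where

    reduce : ℤ → ℕ
    reduce x = x %ℕ p

    reduce-< : ∀ x → reduce x < p
    reduce-< x = n%ℕd<d x p

    reduce-≈ : ∀ x → + reduce x ≈ x
    reduce-≈ x = ≈-sym (mk≈ (divides (x /ℕ p)
      (trans (cong (_- + reduce x) (a≡a%ℕn+[a/ℕn]*n x p)) (identity (+ reduce x) (x /ℕ p) (+ p)))))
      where
      identity : ∀ r q P → r + q * P - r ≡ q * P
      identity = solve-∀

    %-≈ : ∀ n → + (n ℕ.% p) ≈ + n
    %-≈ n = reduce-≈ (+ n)

    reduce-*ˡ : ∀ x y → + reduce x * y ≈ x * y
    reduce-*ˡ x y = *-cong (reduce-≈ x) (≈-refl {y})

    reduce-*ʳ : ∀ x y → x * + reduce y ≈ x * y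
    reduce-*ʳ x y = *-cong (≈-refl {x}) (reduce-≈ y)

    ≈⇒≡ : ∀ {m n} → m < p → n < p → + m ≈ + n → m ≡ n
    ≈⇒≡ {m} {n} m<p n<p (mk≈ p∣m-n) =
      ℤ.+-injective (ℤ.i-j≡0⇒i≡j (+ m) (+ n) (ℤ.∣i∣≡0⇒i≡0 (∣∧<⇒≡0 (∣⇒∣ᵤ p∣m-n) ∣m-n∣<p)))
      where
      ∣m-n∣<p : ∣ + m - + n ∣ < p
      ∣m-n∣<p = ℕ.≤-<-trans (ℕ.≤-reflexive (cong ∣_∣ (ℤ.m-n≡m⊖n m n))) (ℕ.≤-<-trans (ℤ.∣m⊝n∣≤m⊔n m n) (ℕ.⊔-lub m<p n<p))

    reduce≡⇒≈ : ∀ {x y} → reduce x ≡ reduce y → x ≈ y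
    reduce≡⇒≈ {x} {y} eq = ≈-trans (≈-sym (reduce-≈ x)) (≈-trans (≈-reflexive (cong +_ eq)) (reduce-≈ y))

    reduce-cong : ∀ {x y} → x ≈ y → reduce x ≡ reduce y
    reduce-cong {x} {y} d = ≈⇒≡ (reduce-< x) (reduce-< y) (≈-trans (reduce-≈ x) (≈-trans d (≈-sym (reduce-≈ y))))

    infixl 6 _⊟_
    _⊟_ : ℕ → ℕ → ℕ
    c ⊟ a = reduce (+ c - + a)

    ⊟-< : ∀ c a → c ⊟ a < p
    ⊟-< c a = reduce-< (+ c - + a)

    [a+c]%p⊟a≡c : ∀ a {c} → c < p → (a ℕ.+ c) ℕ.% p ⊟ a ≡ c
    [a+c]%p⊟a≡c a {c} c<p = ≈⇒≡ (reduce-< (+ ((a ℕ.+ c) ℕ.% p) - + a)) c<p (begin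
      + reduce (+ ((a ℕ.+ c) ℕ.% p) - + a)   ≈⟨ reduce-≈ (+ ((a ℕ.+ c) ℕ.% p) - + a) ⟩
      + ((a ℕ.+ c) ℕ.% p) - + a              ≈⟨ +-cong (%-≈ (a ℕ.+ c)) (≈-refl { - + a}) ⟩
      + (a ℕ.+ c) - + a                      ≡⟨ cong (_- + a) (ℤ.pos-+ a c) ⟩
      + a + + c - + a                        ≡⟨ identity (+ a) (+ c) ⟩
      + c                                    ∎)
      where
      open ≈-Reasoning
      identity : ∀ a c → a + c - a ≡ c
      identity = solve-∀

    [a+c⊟a]%p≡c : ∀ a {c} → c < p → (a ℕ.+ (c ⊟ a)) ℕ.% p ≡ c
    [a+c⊟a]%p≡c a {c} c<p = ≈⇒≡ (m%n<n (a ℕ.+ (c ⊟ a)) p) c<p (begin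
      + ((a ℕ.+ (c ⊟ a)) ℕ.% p)      ≈⟨ %-≈ (a ℕ.+ (c ⊟ a)) ⟩
      + (a ℕ.+ (c ⊟ a))              ≡⟨ ℤ.pos-+ a (c ⊟ a) ⟩
      + a + + (c ⊟ a)                ≈⟨ +-cong (≈-refl {+ a}) (reduce-≈ (+ c - + a)) ⟩
      + a + (+ c - + a)              ≡⟨ identity (+ a) (+ c) ⟩
      + c                            ∎)
      where
      open ≈-Reasoning
      identity : ∀ a c → a + (c - a) ≡ c
      identity = solve-∀

module PrimeField (p : ℕ) (prime : Prime p) where

  open import Data.Integer using (ℤ; +_; 0ℤ; 1ℤ; _+_; _*_; -_; _-_; _^_; ∣_∣)

  instance
    p≢0 : NonZero p
    p≢0 = prime⇒nonZero prime

  open Congruence p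

  1<p : 1 < p
  1<p = ℕ.nonTrivial⇒n>1 p {{prime⇒nonTrivial prime}}

  ≉0 : ∀ {n} → 0 < n → n < p → ¬ (+ n ≈ 0ℤ)
  ≉0 0<n n<p n≈0 = ℕ.<⇒≢ 0<n (sym (≈⇒≡ n<p (ℕ.<-trans 0<n n<p) n≈0))

  euclid : ∀ {x y} → x * y ≈ 0ℤ → x ≈ 0ℤ ⊎ y ≈ 0ℤ
  euclid {x} {y} xy≈0 with euclidsLemma ∣ x ∣ ∣ y ∣ prime (subst (p ℕ.∣_) (ℤ.abs-* x y) (∣⇒∣ᵤ (≈0⇒∣ xy≈0)))
  ... | inj₁ p∣x = inj₁ (∣⇒≈0 (∣ᵤ⇒∣ p∣x))
  ... | inj₂ p∣y = inj₂ (∣⇒≈0 (∣ᵤ⇒∣ p∣y))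

  *-cancelʳ-≈ : ∀ {w x y} → ¬ (w ≈ 0ℤ) → x * w ≈ y * w → x ≈ y
  *-cancelʳ-≈ {w} {x} {y} w≉0 xw≈yw with euclid (≈-trans (≈-reflexive (identity x y w)) (x≈y⇒x-y≈0 xw≈yw))
    where
    identity : ∀ x y w → (x - y) * w ≡ x * w - y * w
    identity = solve-∀
  ... | inj₁ x-y≈0 = x-y≈0⇒x≈y x-y≈0
  ... | inj₂ w≈0 = ⊥-elim (w≉0 w≈0)

  multiple-≈ : ∀ r k → + (r ℕ.+ k ℕ.* p) ≈ + r
  multiple-≈ r k = ≈-trans (≈-sym (%-≈ (r ℕ.+ k ℕ.* p))) (≈-trans (≈-reflexive (cong +_ ([m+kn]%n≡m%n r k p))) (%-≈ r))

  private
    inverse-ℕ : ∀ {n} → .{{NonZero n}} → n < p → ∃[ y ] + n * y ≈ 1ℤ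
    inverse-ℕ {n} n<p with coprime-Bézout (prime⇒coprime prime n<p)
    ... | Bézout.+- a b 1+bn≡ap = - + b , (begin
      + n * - + b                ≡⟨ identity (+ n) (+ b) ⟩
      1ℤ - (1ℤ + + b * + n)      ≡⟨ cong (λ t → 1ℤ - t) (sym (trans (ℤ.pos-+ 1 (b ℕ.* n)) (cong (λ t → 1ℤ + t) (ℤ.pos-* b n)))) ⟩
      1ℤ - + (1 ℕ.+ b ℕ.* n)     ≈⟨ +-cong (≈-refl {1ℤ}) (-‿cong (≈-trans (≈-reflexive (cong +_ 1+bn≡ap)) (multiple-≈ 0 a))) ⟩
      1ℤ                         ∎)
      where
      open ≈-Reasoning
      identity : ∀ N B → N * - B ≡ 1ℤ - (1ℤ + B * N)
      identity = solve-∀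
    ... | Bézout.-+ a b 1+ap≡bn = + b , (begin
      + n * + b                  ≡⟨ sym (ℤ.pos-* n b) ⟩
      + (n ℕ.* b)                ≡⟨ cong +_ (trans (ℕ.*-comm n b) (sym 1+ap≡bn)) ⟩
      + (1 ℕ.+ a ℕ.* p)          ≈⟨ multiple-≈ 1 a ⟩
      1ℤ                         ∎)
      where open ≈-Reasoning

  inverse : ∀ {x} → ¬ (x ≈ 0ℤ) → ∃[ y ] x * y ≈ 1ℤ
  inverse {x} x≉0 with reduce x in eq
  ... | zero = ⊥-elim (x≉0 (≈-trans (≈-sym (reduce-≈ x)) (≈-reflexive (cong +_ eq))))
  ... | suc n with inverse-ℕ (subst (_< p) eq (reduce-< x))
  ...   | y , ny≈1 = y , ≈-trans (*-cong (≈-trans (≈-sym (reduce-≈ x)) (≈-reflexive (cong +_ eq))) ≈-refl) ny≈1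

  pos-^ : ∀ m n → + (m ℕ.^ n) ≡ (+ m) ^ n
  pos-^ m zero = refl
  pos-^ m (suc n) = trans (ℤ.pos-* m (m ℕ.^ n)) (cong (λ t → + m * t) (pos-^ m n))

  product-≈ : ∀ {f g : ℕ → ℕ} (ns : List ℕ) → (∀ {n} → n ∈ ns → + f n ≈ + g n) →
              + product (map f ns) ≈ + product (map g ns)
  product-≈ [] f≈g = ≈-refl
  product-≈ {f} {g} (n ∷ ns) f≈g = begin
    + (f n ℕ.* product (map f ns))   ≡⟨ ℤ.pos-* (f n) _ ⟩
    + f n * + product (map f ns)     ≈⟨ *-cong (f≈g (here refl)) (product-≈ ns (f≈g ∘ there)) ⟩
    + g n * + product (map g ns)     ≡⟨ sym (ℤ.pos-* (g n) _) ⟩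
    + (g n ℕ.* product (map g ns))   ∎
    where open ≈-Reasoning

  product-≉0 : ∀ (ns : List ℕ) → (∀ {n} → n ∈ ns → ¬ (+ n ≈ 0ℤ)) → ¬ (+ product ns ≈ 0ℤ)
  product-≉0 [] _ = ≉0 ℕ.z<s 1<p
  product-≉0 (n ∷ ns) ≉0s nns≈0 with euclid (≈-trans (≈-reflexive (sym (ℤ.pos-* n (product ns)))) nns≈0)
  ... | inj₁ n≈0 = ≉0s (here refl) n≈0
  ... | inj₂ ns≈0 = product-≉0 ns (≉0s ∘ there) ns≈0

  units : List ℕ
  units = applyUpTo suc (p ℕ.∸ 1)

  ∈-units⁻ : ∀ {n} → n ∈ units → 0 < n × n < p
  ∈-units⁻ n∈ = helper p n∈
    where
    helper : ∀ m {n} → n ∈ applyUpTo suc (m ℕ.∸ 1) → 0 < n × n < m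
    helper (suc m) n∈ with ∈-applyUpTo⁻ suc n∈
    ... | i , i<m , refl = ℕ.z<s , ℕ.s<s i<m

  ∈-units⁺ : ∀ {n} → 0 < n → n < p → n ∈ units
  ∈-units⁺ 0<n n<p = helper p 0<n n<p
    where
    helper : ∀ m {n} → 0 < n → n < m → n ∈ applyUpTo suc (m ℕ.∸ 1)
    helper (suc m) {suc i} _ (s≤s i<m) = ∈-applyUpTo⁺ suc i<m

  upTo≡0∷units : upTo p ≡ 0 ∷ units
  upTo≡0∷units = helper p
    where
    helper : ∀ m .{{_ : NonZero m}} → upTo m ≡ 0 ∷ applyUpTo suc (m ℕ.∸ 1)
    helper (suc m) = refl

  units-unique : Unique units
  units-unique = Unique.applyUpTo⁺₁ suc (p ℕ.∸ 1) (λ i<j _ → ℕ.<⇒≢ (ℕ.s<s i<j))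

  reduce-*-∈-units : ∀ {x n} → ¬ (x ≈ 0ℤ) → n ∈ units → reduce (x * + n) ∈ units
  reduce-*-∈-units {x} {n} x≉0 n∈ with reduce (x * + n) in r≡
  ... | zero = ⊥-elim ([ x≉0 , uncurry ≉0 (∈-units⁻ n∈) ]′
                         (euclid (≈-trans (≈-sym (reduce-≈ (x * + n))) (≈-reflexive (cong +_ r≡)))))
  ... | suc _ = ∈-units⁺ ℕ.z<s (subst (_< p) r≡ (reduce-< (x * + n)))

  reduce-*-cancel : ∀ {x y n} → y * x ≈ 1ℤ → n < p → reduce (y * + reduce (x * + n)) ≡ n
  reduce-*-cancel {x} {y} {n} yx≈1 n<p = ≈⇒≡ (reduce-< (y * + reduce (x * + n))) n<p (begin
    + reduce (y * + reduce (x * + n))   ≈⟨ reduce-≈ (y * + reduce (x * + n)) ⟩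
    y * + reduce (x * + n)              ≈⟨ *-cong (≈-refl {y}) (reduce-≈ (x * + n)) ⟩
    y * (x * + n)                       ≡⟨ sym (ℤ.*-assoc y x (+ n)) ⟩
    y * x * + n                         ≈⟨ *-cong yx≈1 (≈-refl {+ n}) ⟩
    1ℤ * + n                            ≡⟨ ℤ.*-identityˡ (+ n) ⟩
    + n                                 ∎)
    where open ≈-Reasoning

  *-permutes-units : ∀ {x} → ¬ (x ≈ 0ℤ) → map (λ n → reduce (x * + n)) units ↭ units
  *-permutes-units {x} x≉0 =
    map-↭ (λ n → reduce (y * + n)) units-unique units-unique (reduce-*-∈-units x≉0) (reduce-*-∈-units y≉0)
      (reduce-*-cancel {x} {y} (≈-trans (≈-reflexive (ℤ.*-comm y x)) xy≈1) ∘ proj₂ ∘ ∈-units⁻)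
      (reduce-*-cancel {y} {x} xy≈1 ∘ proj₂ ∘ ∈-units⁻)
    where
    y : ℤ
    y = proj₁ (inverse x≉0)
    xy≈1 : x * y ≈ 1ℤ
    xy≈1 = proj₂ (inverse x≉0)
    y≉0 : ¬ (y ≈ 0ℤ)
    y≉0 y≈0 = ≉0 ℕ.z<s 1<p (≈-trans (≈-sym xy≈1) (≈-trans (*-cong (≈-refl {x}) y≈0) (≈-reflexive (ℤ.*-zeroʳ x))))

  fermat : ∀ {x} → ¬ (x ≈ 0ℤ) → x ^ (p ℕ.∸ 1) ≈ 1ℤ
  fermat {x} x≉0 = *-cancelʳ-≈ (product-≉0 units (uncurry ≉0 ∘ ∈-units⁻)) (begin
    x ^ (p ℕ.∸ 1) * + W                            ≈⟨ *-cong (^-cong (p ℕ.∸ 1) (≈-sym (reduce-≈ x))) (≈-refl {+ W}) ⟩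
    (+ a) ^ (p ℕ.∸ 1) * + W                        ≡⟨ cong (λ k → (+ a) ^ k * + W) (sym (length-applyUpTo suc (p ℕ.∸ 1))) ⟩
    (+ a) ^ length units * + W                     ≡⟨ cong (_* + W) (sym (pos-^ a (length units))) ⟩
    + (a ℕ.^ length units) * + W                   ≡⟨ sym (ℤ.pos-* (a ℕ.^ length units) W) ⟩
    + (a ℕ.^ length units ℕ.* W)                   ≡⟨ cong +_ (sym (product-map-*ˡ a units)) ⟩
    + product (map (a ℕ.*_) units)                 ≈⟨ product-≈ units (λ {n} _ → a*n≈x*n n) ⟩
    + product (map (λ n → reduce (x * + n)) units) ≡⟨ cong +_ (product-↭ (*-permutes-units x≉0)) ⟩
    + W                                            ≡⟨ sym (ℤ.*-identityˡ (+ W)) ⟩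
    1ℤ * + W                                       ∎)
    where
    open ≈-Reasoning
    a = reduce x
    W = product units
    a*n≈x*n : ∀ n → + (a ℕ.* n) ≈ + reduce (x * + n)
    a*n≈x*n n = ≈-trans (≈-reflexive (ℤ.pos-* a n)) (≈-trans (*-cong (reduce-≈ x) (≈-refl {+ n})) (≈-sym (reduce-≈ (x * + n))))

  ≈0? : ∀ x → Dec (x ≈ 0ℤ)
  ≈0? x with reduce x ℕ.≟ 0
  ... | yes r≡0 = yes (≈-trans (≈-sym (reduce-≈ x)) (≈-reflexive (cong +_ r≡0)))
  ... | no r≢0 = no (λ x≈0 → r≢0 (trans (reduce-cong x≈0) (m<n⇒m%n≡m (ℕ.<-trans ℕ.z<s 1<p))))

  -- x^(p−1) = (x²)^h with h = (p − 1)/2 odd, so x² ≈ −1 would give 1 ≈ −1, i.e. p ∣ 2.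
  -1-nonsquare : p ℕ.% 4 ≡ 3 → ∀ x → ¬ (x * x ≈ - 1ℤ)
  -1-nonsquare p%4≡3 x x²≈-1 = ≉0 (s≤s z≤n) 2<p (+-cong 1≈-1 (≈-refl {1ℤ}))
    where
    k : ℕ
    k = proj₁ (%4≡3⇒ {p} p%4≡3)
    p≡3+4k : p ≡ 3 ℕ.+ k ℕ.* 4
    p≡3+4k = proj₂ (%4≡3⇒ {p} p%4≡3)
    2<p : 2 < p
    2<p = subst (2 <_) (sym p≡3+4k) (s≤s (s≤s (s≤s z≤n)))
    h : ℕ
    h = 1 ℕ.+ 2 ℕ.* k
    p-1≡2h : p ℕ.∸ 1 ≡ 2 ℕ.* h
    p-1≡2h = trans (cong (ℕ._∸ 1) p≡3+4k) (identity k)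
      where
      identity : ∀ k → 2 ℕ.+ k ℕ.* 4 ≡ 2 ℕ.* (1 ℕ.+ 2 ℕ.* k)
      identity = ℕ-Solver.solve-∀
    x≉0 : ¬ (x ≈ 0ℤ)
    x≉0 x≈0 = ≉0 ℕ.z<s 1<p (-‿cong (≈-trans (≈-sym x²≈-1) (*-cong x≈0 x≈0)))
    -1^odd : ∀ k → (- 1ℤ) ^ (1 ℕ.+ 2 ℕ.* k) ≡ - 1ℤ
    -1^odd k = cong (- 1ℤ *_) (trans (sym (ℤ.^-*-assoc (- 1ℤ) 2 k)) (ℤ.^-zeroˡ k))
    1≈-1 : 1ℤ ≈ - 1ℤ
    1≈-1 = begin
      1ℤ                  ≈⟨ ≈-sym (fermat x≉0) ⟩
      x ^ (p ℕ.∸ 1)       ≡⟨ cong (x ^_) p-1≡2h ⟩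
      x ^ (2 ℕ.* h)       ≡⟨ sym (ℤ.^-*-assoc x 2 h) ⟩
      (x ^ 2) ^ h         ≡⟨ cong (λ y → (x * y) ^ h) (ℤ.*-identityʳ x) ⟩
      (x * x) ^ h         ≈⟨ ^-cong h x²≈-1 ⟩
      (- 1ℤ) ^ h          ≡⟨ -1^odd k ⟩
      - 1ℤ                ∎
      where open ≈-Reasoning

  squares-sum≈0 : p ℕ.% 4 ≡ 3 → ∀ {x y} → x * x + y * y ≈ 0ℤ → x ≈ 0ℤ × y ≈ 0ℤ
  squares-sum≈0 p%4≡3 {x} {y} sum≈0 =
    second-≈0 {y} {x} (≈-trans (≈-reflexive (ℤ.+-comm (y * y) (x * x))) sum≈0) , second-≈0 {x} {y} sum≈0
    where
    second-≈0 : ∀ {x y} → x * x + y * y ≈ 0ℤ → y ≈ 0ℤ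
    second-≈0 {x} {y} sum≈0 with ≈0? y
    ... | yes y≈0 = y≈0
    ... | no y≉0 = ⊥-elim (-1-nonsquare p%4≡3 (x * z) (begin
      (x * z) * (x * z)                               ≡⟨ identity x y z ⟩
      (x * x + y * y) * (z * z) - (y * z) * (y * z)   ≈⟨ +-cong (*-cong sum≈0 (≈-refl {z * z})) (-‿cong (*-cong yz≈1 yz≈1)) ⟩
      0ℤ * (z * z) - 1ℤ * 1ℤ                          ≡⟨ cong (_- 1ℤ) (ℤ.*-zeroˡ (z * z)) ⟩
      - 1ℤ                                            ∎))
      where
      open ≈-Reasoning
      z : ℤ
      z = proj₁ (inverse y≉0)
      yz≈1 : y * z ≈ 1ℤ
      yz≈1 = proj₂ (inverse y≉0)
      identity : ∀ x y z → (x * z) * (x * z) ≡ (x * x + y * y) * (z * z) - (y * z) * (y * z)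
      identity = solve-∀

  squares-injective : ∀ {m n} → m ℕ.+ n < p → + m * + m ≈ + n * + n → m ≡ n
  squares-injective {m} {n} m+n<p m²≈n² with euclid (≈-trans (≈-reflexive (identity (+ m) (+ n))) (x≈y⇒x-y≈0 m²≈n²))
    where
    identity : ∀ m n → (m - n) * (m + n) ≡ m * m - n * n
    identity = solve-∀
  ... | inj₁ m-n≈0 = ≈⇒≡ (ℕ.≤-<-trans (ℕ.m≤m+n m n) m+n<p) (ℕ.≤-<-trans (ℕ.m≤n+m n m) m+n<p) (x-y≈0⇒x≈y m-n≈0)
  ... | inj₂ m+n≈0 with ≈⇒≡ m+n<p (ℕ.≤-<-trans ℕ.z≤n m+n<p) (≈-trans (≈-reflexive (sym (ℤ.pos-+ m n))) m+n≈0)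
  ...   | m+n≡0 = trans (ℕ.m+n≡0⇒m≡0 m m+n≡0) (sym (ℕ.m+n≡0⇒n≡0 m m+n≡0))

module Plane (p : ℕ) .{{_ : NonZero p}} where

  points≡cartesianProduct : points p ≡ cartesianProduct (upTo p) (upTo p)
  points≡cartesianProduct = concatMap-map≡cartesianProduct (upTo p) (upTo p)

  ∈-points⁺ : ∀ {u v} → u < p → v < p → (u , v) ∈ points p
  ∈-points⁺ u<p v<p = subst ((_ , _) ∈_) (sym points≡cartesianProduct) (∈-cartesianProduct⁺ (∈-upTo⁺ u<p) (∈-upTo⁺ v<p))

  ∈-points⁻ : ∀ {u v} → (u , v) ∈ points p → u < p × v < p
  ∈-points⁻ {u} {v} uv∈ with ∈-cartesianProduct⁻ (upTo p) (upTo p) (subst ((u , v) ∈_) points≡cartesianProduct uv∈)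
  ... | u∈ , v∈ = ∈-upTo⁻ u∈ , ∈-upTo⁻ v∈

  origin∈ : (0 , 0) ∈ points p
  origin∈ = ∈-points⁺ (ℕ.>-nonZero⁻¹ p) (ℕ.>-nonZero⁻¹ p)

  points-unique : Unique (points p)
  points-unique = subst Unique (sym points≡cartesianProduct) (Unique.cartesianProduct⁺ (Unique.upTo⁺ p) (Unique.upTo⁺ p))

  length-points : length (points p) ≡ p ℕ.* p
  length-points = trans (cong length points≡cartesianProduct)
    (trans (length-cartesianProduct (upTo p) (upTo p)) (cong₂ ℕ._*_ (length-upTo p) (length-upTo p)))

  ∈-circle⁺ : ∀ {x K} → x ∈ points p → norm p x ≡ K → x ∈ circle p K
  ∈-circle⁺ x∈ nx≡K = ∈-filter⁺ _ x∈ nx≡K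

  ∈-circle⁻ : ∀ {x K} → x ∈ circle p K → x ∈ points p × norm p x ≡ K
  ∈-circle⁻ = ∈-filter⁻ _

  norm<p : ∀ x → norm p x < p
  norm<p (u , v) = m%n<n (u ℕ.* u ℕ.+ v ℕ.* v) p

  circle-unique : ∀ K → Unique (circle p K)
  circle-unique K = Unique.filter⁺ _ points-unique

module Circles (p : ℕ) (prime : Prime p) where

  open import Data.Integer using (ℤ; +_; 0ℤ; 1ℤ; _+_; _*_; -_; _-_)
  open PrimeField p prime
  open Congruence p
  open Plane p

  norm-≈ : ∀ u v → + norm p (u , v) ≈ + u * + u + + v * + v
  norm-≈ u v = ≈-trans (%-≈ (u ℕ.* u ℕ.+ v ℕ.* v))
    (≈-reflexive (trans (ℤ.pos-+ (u ℕ.* u) (v ℕ.* v)) (cong₂ _+_ (ℤ.pos-* u u) (ℤ.pos-* v v))))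

  module _ (h : ℕ) (p≡2h+1 : p ≡ suc (h ℕ.+ h)) where

    private
      bound : (a : Fin (suc h)) → toℕ a < p
      bound a = subst (_ <_) (sym p≡2h+1) (s≤s (ℕ.≤-trans (ℕ.≤-pred (Fin.toℕ<n a)) (ℕ.m≤m+n h h)))

      sum-bound : (a b : Fin (suc h)) → toℕ a ℕ.+ toℕ b < p
      sum-bound a b = subst (_ <_ ) (sym p≡2h+1) (s≤s (ℕ.+-mono-≤ (ℕ.≤-pred (Fin.toℕ<n a)) (ℕ.≤-pred (Fin.toℕ<n b))))

      residue : ℤ → Fin p
      residue x = fromℕ< (reduce-< x)

      residue-≈ : ∀ {x y} → residue x ≡ residue y → x ≈ y
      residue-≈ {x} {y} eq = reduce≡⇒≈ (trans (sym (Fin.toℕ-fromℕ< (reduce-< x))) (trans (cong toℕ eq) (Fin.toℕ-fromℕ< (reduce-< y))))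

      K-cancel : ∀ {K x y} → + K - x ≈ + K - y → x ≈ y
      K-cancel {K} {x} {y} eq =
        ≈-trans (≈-reflexive (identity (+ K) x)) (≈-trans (+-cong (-‿cong eq) ≈-refl) (≈-reflexive (sym (identity (+ K) y))))
        where
        identity : ∀ k x → x ≡ - (k - x) + k
        identity = solve-∀

      square : Fin (suc h) → Fin p
      square a = residue (+ toℕ a * + toℕ a)

      square-injective : Injective _≡_ _≡_ square
      square-injective {a} {b} eq =
        Fin.toℕ-injective (squares-injective (sum-bound a b) (residue-≈ {+ toℕ a * + toℕ a} {+ toℕ b * + toℕ b} eq))

      difference : ℕ → Fin (suc h) → Fin p
      difference K b = residue (+ K - + toℕ b * + toℕ b)

      difference-injective : ∀ K → Injective _≡_ _≡_ (difference K)
      difference-injective K {a} {b} eq =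
        Fin.toℕ-injective (squares-injective (sum-bound a b)
          (K-cancel (residue-≈ {+ K - + toℕ a * + toℕ a} {+ K - + toℕ b * + toℕ b} eq)))

    -- The h + 1 residues a² and the h + 1 residues K − b² (a, b ≤ h) are pairwise distinct within
    -- each family, and 2h + 2 > p.
    squares-meet : ∀ K → ∃₂ λ (a b : Fin (suc h)) → + toℕ a * + toℕ a ≈ + K - + toℕ b * + toℕ b
    squares-meet K =
      let a , b , eq = pigeonhole-two-families p<2h+2 square (difference K) square-injective (difference-injective K)
      in a , b , residue-≈ {+ toℕ a * + toℕ a} {+ K - + toℕ b * + toℕ b} eq
      where
      p<2h+2 : p < suc h ℕ.+ suc h
      p<2h+2 = ℕ.≤-reflexive (trans (cong suc p≡2h+1) (sym (ℕ.+-suc (suc h) h)))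

    sum-of-two-squares : ∀ {K} → K < p → ∃[ x ] x ∈ circle p K
    sum-of-two-squares {K} K<p =
      let a , b , a²≈K-b² = squares-meet K
          u = toℕ a ; v = toℕ b
      in (u , v) , ∈-circle⁺ (∈-points⁺ (bound a) (bound b)) (≈⇒≡ (norm<p (u , v)) K<p (begin
        + norm p (u , v)                ≈⟨ norm-≈ u v ⟩
        + u * + u + + v * + v           ≈⟨ +-cong a²≈K-b² (≈-refl {+ v * + v}) ⟩
        + K - + v * + v + + v * + v     ≡⟨ identity (+ K) (+ v * + v) ⟩
        + K                             ∎))
      where
      open ≈-Reasoning
      identity : ∀ k y → k - y + y ≡ k
      identity = solve-∀

  -- (a + bi)(u + vi), reduced modulo p.
  infixl 7 _⊗_
  _⊗_ : Pt → Pt → Pt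
  (a , b) ⊗ (u , v) = reduce (+ a * + u - + b * + v) , reduce (+ a * + v + + b * + u)

  ⊗-∈-points : ∀ g x → g ⊗ x ∈ points p
  ⊗-∈-points (a , b) (u , v) = ∈-points⁺ (reduce-< (+ a * + u - + b * + v)) (reduce-< (+ a * + v + + b * + u))

  ⊗-comm : ∀ g x → g ⊗ x ≡ x ⊗ g
  ⊗-comm (a , b) (u , v) = cong₂ _,_ (cong reduce (re (+ a) (+ b) (+ u) (+ v))) (cong reduce (im (+ a) (+ b) (+ u) (+ v)))
    where
    re : ∀ a b u v → a * u - b * v ≡ u * a - v * b
    re = solve-∀
    im : ∀ a b u v → a * v + b * u ≡ u * b + v * a
    im = solve-∀

  ⊗-identityˡ : ∀ {x} → x ∈ points p → (1 , 0) ⊗ x ≡ x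
  ⊗-identityˡ {u , v} x∈ = cong₂ _,_
    (trans (cong reduce (re (+ u) (+ v))) (m<n⇒m%n≡m (proj₁ (∈-points⁻ x∈))))
    (trans (cong reduce (im (+ u) (+ v))) (m<n⇒m%n≡m (proj₂ (∈-points⁻ x∈))))
    where
    re : ∀ u v → 1ℤ * u - 0ℤ * v ≡ u
    re = solve-∀
    im : ∀ u v → 1ℤ * v + 0ℤ * u ≡ v
    im = solve-∀

  ⊗-assoc : ∀ g h x → (g ⊗ h) ⊗ x ≡ g ⊗ (h ⊗ x)
  ⊗-assoc (a , b) (c , d) (u , v) = cong₂ _,_
    (reduce-cong (begin
      + reduce re₁ * u′ - + reduce im₁ * v′   ≈⟨ +-cong (reduce-*ˡ re₁ u′) (-‿cong (reduce-*ˡ im₁ v′)) ⟩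
      re₁ * u′ - im₁ * v′                     ≡⟨ re a′ b′ c′ d′ u′ v′ ⟩
      a′ * re₂ - b′ * im₂                     ≈⟨ ≈-sym (+-cong (reduce-*ʳ a′ re₂) (-‿cong (reduce-*ʳ b′ im₂))) ⟩
      a′ * + reduce re₂ - b′ * + reduce im₂   ∎))
    (reduce-cong (begin
      + reduce re₁ * v′ + + reduce im₁ * u′   ≈⟨ +-cong (reduce-*ˡ re₁ v′) (reduce-*ˡ im₁ u′) ⟩
      re₁ * v′ + im₁ * u′                     ≡⟨ im a′ b′ c′ d′ u′ v′ ⟩
      a′ * im₂ + b′ * re₂                     ≈⟨ ≈-sym (+-cong (reduce-*ʳ a′ im₂) (reduce-*ʳ b′ re₂)) ⟩
      a′ * + reduce im₂ + b′ * + reduce re₂   ∎))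
    where
    open ≈-Reasoning
    a′ = + a ; b′ = + b ; c′ = + c ; d′ = + d ; u′ = + u ; v′ = + v
    re₁ = a′ * c′ - b′ * d′
    im₁ = a′ * d′ + b′ * c′
    re₂ = c′ * u′ - d′ * v′
    im₂ = c′ * v′ + d′ * u′
    re : ∀ a b c d u v → (a * c - b * d) * u - (a * d + b * c) * v ≡ a * (c * u - d * v) - b * (c * v + d * u)
    re = solve-∀
    im : ∀ a b c d u v → (a * c - b * d) * v + (a * d + b * c) * u ≡ a * (c * v + d * u) + b * (c * u - d * v)
    im = solve-∀

  norm-⊗ : ∀ g x → + norm p (g ⊗ x) ≈ + norm p g * + norm p x
  norm-⊗ (a , b) (u , v) = begin
    + norm p (reduce re , reduce im)                         ≈⟨ norm-≈ (reduce re) (reduce im) ⟩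
    + reduce re * + reduce re + + reduce im * + reduce im    ≈⟨ +-cong (*-cong (reduce-≈ re) (reduce-≈ re)) (*-cong (reduce-≈ im) (reduce-≈ im)) ⟩
    re * re + im * im                                        ≡⟨ identity a′ b′ u′ v′ ⟩
    (a′ * a′ + b′ * b′) * (u′ * u′ + v′ * v′)                ≈⟨ ≈-sym (*-cong (norm-≈ a b) (norm-≈ u v)) ⟩
    + norm p (a , b) * + norm p (u , v)                      ∎
    where
    open ≈-Reasoning
    a′ = + a ; b′ = + b ; u′ = + u ; v′ = + v
    re = a′ * u′ - b′ * v′
    im = a′ * v′ + b′ * u′
    identity : ∀ a b u v → (a * u - b * v) * (a * u - b * v) + (a * v + b * u) * (a * v + b * u)
                           ≡ (a * a + b * b) * (u * u + v * v)
    identity = solve-∀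

  -- The inverse is N(g)⁻¹ · conj g.
  ⊗-inverse : ∀ {g} → g ∈ points p → ¬ (+ norm p g ≈ 0ℤ) → ∃[ g′ ] g′ ⊗ g ≡ (1 , 0)
  ⊗-inverse {a , b} g∈ N≉0 = (reduce (c * a′) , reduce (- (c * b′))) , cong₂ _,_
    (trans (reduce-cong (begin
      + reduce (c * a′) * a′ - + reduce (- (c * b′)) * b′   ≈⟨ +-cong (reduce-*ˡ (c * a′) a′) (-‿cong (reduce-*ˡ (- (c * b′)) b′)) ⟩
      c * a′ * a′ - - (c * b′) * b′                         ≡⟨ re c a′ b′ ⟩
      (a′ * a′ + b′ * b′) * c                               ≈⟨ *-cong (≈-sym (norm-≈ a b)) (≈-refl {c}) ⟩
      + norm p (a , b) * c                                  ≈⟨ proj₂ (inverse N≉0) ⟩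
      1ℤ                                                    ∎)) (m<n⇒m%n≡m 1<p))
    (trans (reduce-cong (begin
      + reduce (c * a′) * b′ + + reduce (- (c * b′)) * a′   ≈⟨ +-cong (reduce-*ˡ (c * a′) b′) (reduce-*ˡ (- (c * b′)) a′) ⟩
      c * a′ * b′ + - (c * b′) * a′                         ≡⟨ im c a′ b′ ⟩
      0ℤ                                                    ∎)) (m<n⇒m%n≡m (ℕ.<-trans ℕ.z<s 1<p)))
    where
    open ≈-Reasoning
    a′ = + a ; b′ = + b
    c : ℤ
    c = proj₁ (inverse N≉0)
    re : ∀ c a b → c * a * a - - (c * b) * b ≡ (a * a + b * b) * c
    re = solve-∀
    im : ∀ c a b → c * a * b + - (c * b) * a ≡ 0ℤ
    im = solve-∀

  ⊗-permutes-circles : ∀ {g K} → 0 < K → K < p → g ∈ circle p K → map (g ⊗_) (circle p 1) ↭ circle p K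
  ⊗-permutes-circles {g} {K} 0<K K<p g∈ = map-↭ (g′ ⊗_) (circle-unique 1) (circle-unique K) σ∈ τ∈ τσ στ
    where
    K≉0 : ¬ (+ K ≈ 0ℤ)
    K≉0 = ≉0 0<K K<p
    Ng≈K : + norm p g ≈ + K
    Ng≈K = ≈-reflexive (cong +_ (proj₂ (∈-circle⁻ g∈)))
    g′ : Pt
    g′ = proj₁ (⊗-inverse (proj₁ (∈-circle⁻ g∈)) (K≉0 ∘ ≈-trans (≈-sym Ng≈K)))
    g′g≡1 : g′ ⊗ g ≡ (1 , 0)
    g′g≡1 = proj₂ (⊗-inverse (proj₁ (∈-circle⁻ g∈)) (K≉0 ∘ ≈-trans (≈-sym Ng≈K)))
    τσ : ∀ {x} → x ∈ circle p 1 → g′ ⊗ (g ⊗ x) ≡ x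
    τσ {x} x∈ = trans (sym (⊗-assoc g′ g x)) (trans (cong (_⊗ x) g′g≡1) (⊗-identityˡ (proj₁ (∈-circle⁻ x∈))))
    στ : ∀ {y} → y ∈ circle p K → g ⊗ (g′ ⊗ y) ≡ y
    στ {y} y∈ = trans (sym (⊗-assoc g g′ y))
      (trans (cong (_⊗ y) (trans (⊗-comm g g′) g′g≡1)) (⊗-identityˡ (proj₁ (∈-circle⁻ y∈))))
    σ∈ : ∀ {x} → x ∈ circle p 1 → g ⊗ x ∈ circle p K
    σ∈ {x} x∈ = ∈-circle⁺ (⊗-∈-points g x) (≈⇒≡ (norm<p (g ⊗ x)) K<p (begin
      + norm p (g ⊗ x)           ≈⟨ norm-⊗ g x ⟩
      + norm p g * + norm p x    ≈⟨ *-cong Ng≈K (≈-reflexive (cong +_ (proj₂ (∈-circle⁻ x∈)))) ⟩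
      + K * 1ℤ                   ≡⟨ ℤ.*-identityʳ (+ K) ⟩
      + K                        ∎))
      where open ≈-Reasoning
    τ∈ : ∀ {y} → y ∈ circle p K → g′ ⊗ y ∈ circle p 1
    τ∈ {y} y∈ = ∈-circle⁺ (⊗-∈-points g′ y) (≈⇒≡ (norm<p (g′ ⊗ y)) 1<p (*-cancelʳ-≈ K≉0 (begin
      + norm p (g′ ⊗ y) * + K           ≡⟨ ℤ.*-comm (+ norm p (g′ ⊗ y)) (+ K) ⟩
      + K * + norm p (g′ ⊗ y)           ≈⟨ *-cong (≈-sym Ng≈K) (≈-refl {+ norm p (g′ ⊗ y)}) ⟩
      + norm p g * + norm p (g′ ⊗ y)    ≈⟨ ≈-sym (norm-⊗ g (g′ ⊗ y)) ⟩
      + norm p (g ⊗ (g′ ⊗ y))           ≡⟨ cong (+_ ∘ norm p) (στ y∈) ⟩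
      + norm p y                        ≡⟨ cong +_ (proj₂ (∈-circle⁻ y∈)) ⟩
      + K                               ≡⟨ sym (ℤ.*-identityˡ (+ K)) ⟩
      1ℤ * + K                          ∎)))
      where open ≈-Reasoning

  circle-length-invariant : ∀ h → p ≡ suc (h ℕ.+ h) → ∀ {K} → 0 < K → K < p → length (circle p K) ≡ length (circle p 1)
  circle-length-invariant h p≡2h+1 {K} 0<K K<p =
    let g , g∈ = sum-of-two-squares h p≡2h+1 K<p
    in trans (sym (↭.↭-length (⊗-permutes-circles 0<K K<p g∈))) (length-map (g ⊗_) (circle p 1))

module CircleSizes (p : ℕ) (prime : Prime p) (p%4≡3 : p ℕ.% 4 ≡ 3) where

  open import Data.Integer using (+_; 0ℤ; _+_; _*_)
  open PrimeField p prime
  open Congruence p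
  open Plane p
  open Circles p prime

  private
    h : ℕ
    h = proj₁ (%4≡3⇒odd {p} p%4≡3)
    p≡2h+1 : p ≡ suc (h ℕ.+ h)
    p≡2h+1 = proj₂ (%4≡3⇒odd {p} p%4≡3)

  circle-0-length : length (circle p 0) ≡ 1
  circle-0-length = length≡1 (circle-unique 0) (∈-circle⁺ origin∈ (m<n⇒m%n≡m 0<p)) only-origin
    where
    0<p : 0 < p
    0<p = ℕ.<-trans ℕ.z<s 1<p
    only-origin : ∀ {x} → x ∈ circle p 0 → x ≡ (0 , 0)
    only-origin {u , v} x∈ =
      let u≈0 , v≈0 = squares-sum≈0 p%4≡3 (≈-trans (≈-sym (norm-≈ u v)) (≈-reflexive (cong +_ (proj₂ (∈-circle⁻ x∈)))))
          u<p , v<p = ∈-points⁻ (proj₁ (∈-circle⁻ x∈))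
      in cong₂ _,_ (≈⇒≡ u<p 0<p u≈0) (≈⇒≡ v<p 0<p v≈0)

  circle-lengths-sum : ∑ (upTo p) (λ K → length (circle p K)) ≡ p ℕ.* p
  circle-lengths-sum =
    trans (sym (length-fibres ℕ._≟_ (norm p) (points p) (Unique.upTo⁺ p) (λ {x} _ → ∈-upTo⁺ (norm<p x)))) length-points

  circle-1-length : length (circle p 1) ≡ suc p
  circle-1-length = m*m≡1+[m∸1]*c⇒c≡1+m 1<p (begin
    p ℕ.* p                                                       ≡⟨ sym circle-lengths-sum ⟩
    ∑ (upTo p) (λ K → length (circle p K))                        ≡⟨ cong (λ ks → ∑ ks (λ K → length (circle p K))) upTo≡0∷units ⟩
    length (circle p 0) ℕ.+ ∑ units (λ K → length (circle p K))   ≡⟨ cong₂ ℕ._+_ circle-0-length (∑-cong {xs = units} invariant) ⟩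
    1 ℕ.+ ∑ units (λ _ → length (circle p 1))                     ≡⟨ cong suc (∑-const (length (circle p 1)) units) ⟩
    1 ℕ.+ length units ℕ.* length (circle p 1)                    ≡⟨ cong (λ n → 1 ℕ.+ n ℕ.* length (circle p 1)) (length-applyUpTo suc (p ℕ.∸ 1)) ⟩
    1 ℕ.+ (p ℕ.∸ 1) ℕ.* length (circle p 1)                       ∎)
    where
    open ≡-Reasoning
    invariant : ∀ {K} → K ∈ units → length (circle p K) ≡ length (circle p 1)
    invariant K∈ = uncurry (circle-length-invariant h p≡2h+1) (∈-units⁻ K∈)

  circle-length : ∀ {K} → 0 < K → K < p → length (circle p K) ≡ suc p
  circle-length 0<K K<p = trans (circle-length-invariant h p≡2h+1 0<K K<p) circle-1-length

module Convergence where

  open import Data.Integer using (ℤ; +_; -[1+_]; _⊖_)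
  open import Data.Nat using (_+_; _*_; _^_; _%_; _/_)
  open import Data.Rational using (ℚ; mkℚ; 0ℚ; ↥_; ↧ₙ_; ∣_∣; _-_; toℚᵘ)
  open import Data.Rational.Unnormalised using (mkℚᵘ; *<*)

  bernoulli : ∀ B P k → B ^ k * ((B + P) + k * P) ≤ (B + P) ^ k * (B + P)
  bernoulli B P zero = ℕ.≤-reflexive (cong (1 *_) (ℕ.+-identityʳ (B + P)))
  bernoulli B P (suc k) = begin
    B * B ^ k * (B + P + (P + k * P))                     ≡⟨ split B (B ^ k) (B + P) P k ⟩
    B * (B ^ k * (B + P + k * P)) + B * B ^ k * P         ≤⟨ ℕ.+-mono-≤ (ℕ.*-monoʳ-≤ B (bernoulli B P k))
                                                                        (ℕ.*-monoˡ-≤ P (ℕ.^-monoˡ-≤ (suc k) (ℕ.m≤m+n B P))) ⟩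
    B * ((B + P) ^ k * (B + P)) + (B + P) ^ suc k * P     ≡⟨ merge B P ((B + P) ^ k) ⟩
    (B + P) ^ suc k * (B + P)                             ∎
    where
    open ℕ.≤-Reasoning
    split : ∀ B Bᵏ Q P k → B * Bᵏ * (Q + (P + k * P)) ≡ B * (Bᵏ * (Q + k * P)) + B * Bᵏ * P
    split = ℕ-Solver.solve-∀
    merge : ∀ B P Qᵏ → B * (Qᵏ * (B + P)) + (B + P) * Qᵏ * P ≡ (B + P) * Qᵏ * (B + P)
    merge = ℕ-Solver.solve-∀

  geometric-decay : ∀ B P d k → 2 ≤ P → (B + P) * d ≤ k → B ^ k * d < (B + P) ^ k
  geometric-decay B P d k 2≤P k≥Qd = half-< (ℕ.≤-trans (ℕ.*-monoʳ-≤ (B ^ k * d) 2≤P) Bᵏ*d*P≤Qᵏ) 0<Qᵏ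
    where
    Q = B + P
    instance
      Q≢0 : NonZero Q
      Q≢0 = ℕ.>-nonZero (ℕ.<-≤-trans (s≤s z≤n) (ℕ.≤-trans 2≤P (ℕ.m≤n+m P B)))
    0<Qᵏ : 0 < Q ^ k
    0<Qᵏ = ℕ.m^n>0 Q k
    half-< : ∀ {x y} → x * 2 ≤ y → 0 < y → x < y
    half-< {zero} _ 0<y = 0<y
    half-< {suc x} {y} 2x≤y _ = ℕ.<-≤-trans (ℕ.m<m+n (suc x) (s≤s z≤n)) (subst (_≤ y) (identity x) 2x≤y)
      where
      identity : ∀ x → suc x * 2 ≡ suc x + suc x
      identity = ℕ-Solver.solve-∀
    Bᵏ*d*P≤Qᵏ : B ^ k * d * P ≤ Q ^ k
    Bᵏ*d*P≤Qᵏ = ℕ.*-cancelʳ-≤ (B ^ k * d * P) (Q ^ k) Q (begin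
      B ^ k * d * P * Q         ≡⟨ identity (B ^ k) Q d P ⟩
      B ^ k * (Q * d * P)       ≤⟨ ℕ.*-monoʳ-≤ (B ^ k) (ℕ.*-monoˡ-≤ P k≥Qd) ⟩
      B ^ k * (k * P)           ≤⟨ ℕ.*-monoʳ-≤ (B ^ k) (ℕ.m≤n+m (k * P) Q) ⟩
      B ^ k * (Q + k * P)       ≤⟨ bernoulli B P k ⟩
      Q ^ k * Q                 ∎)
      where
      open ℕ.≤-Reasoning
      identity : ∀ Bᵏ Q d P → Bᵏ * d * P * Q ≡ Bᵏ * (Q * d * P)
      identity = ℕ-Solver.solve-∀

  ∣⊖∣≤ : ∀ {a b Z} → a ≤ b + Z → b ≤ a + Z → ℤ.∣ a ⊖ b ∣ ≤ Z
  ∣⊖∣≤ {a} {b} {Z} a≤b+Z b≤a+Z with ℕ.≤-total b a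
  ... | inj₁ b≤a = subst (_≤ Z) (sym (cong ℤ.∣_∣ (ℤ.⊖-≥ b≤a)))
                     (ℕ.≤-trans (ℕ.∸-monoˡ-≤ b a≤b+Z) (ℕ.≤-reflexive (ℕ.m+n∸m≡n b Z)))
  ... | inj₂ a≤b = subst (_≤ Z) (sym (trans (cong ℤ.∣_∣ (ℤ.⊖-≤ a≤b)) (ℤ.∣-i∣≡∣i∣ (+ (b ℕ.∸ a)))))
                     (ℕ.≤-trans (ℕ.∸-monoˡ-≤ a b≤a+Z) (ℕ.≤-reflexive (ℕ.m+n∸m≡n a Z)))

  ∣frac-frac∣< : ∀ H G m n Z (ε : ℚ) num → ↥ ε ≡ + suc num → .{{NonZero m}} → .{{NonZero n}} →
                 H * n ≤ G * m + Z → G * m ≤ H * n + Z → Z * ↧ₙ ε < suc num * (m * n) →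
                 ∣ frac H m - frac G n ∣ ℚ.< ε
  ∣frac-frac∣< H G (suc m) (suc n) Z ε@(mkℚ _ d _) num ↥ε≡ Hn≤ Gm≤ Zd< =
    ℚ.toℚᵘ-cancel-< (ℚᵘ.<-respˡ-≃ (ℚᵘ.≃-sym unnormalise) (*<* cross-multiplied))
    where
    x = frac H (suc m)
    y = frac G (suc n)
    unnormalise : toℚᵘ ∣ x - y ∣ ℚᵘ.≃ ℚᵘ.∣ mkℚᵘ (+ H) m ℚᵘ.+ ℚᵘ.- mkℚᵘ (+ G) n ∣
    unnormalise = ℚᵘ.≃-trans (ℚ.toℚᵘ-homo-∣-∣ (x - y))
      (ℚᵘ.∣-∣-cong (ℚᵘ.≃-trans (ℚ.toℚᵘ-homo-+ x (ℚ.- y))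
        (ℚᵘ.+-cong (ℚ.toℚᵘ-fromℚᵘ (mkℚᵘ (+ H) m))
          (ℚᵘ.≃-trans (ℚ.toℚᵘ-homo‿- y) (ℚᵘ.-‿cong (ℚ.toℚᵘ-fromℚᵘ (mkℚᵘ (+ G) n)))))))
    numerator : ℤ
    numerator = + H ℤ.* + suc n ℤ.+ ℤ.- (+ G) ℤ.* + suc m
    numerator≡ : numerator ≡ H * suc n ⊖ G * suc m
    numerator≡ = trans (cong₂ ℤ._+_ (sym (ℤ.pos-* H (suc n)))
                         (trans (sym (ℤ.neg-distribˡ-* (+ G) (+ suc m))) (cong ℤ.-_ (sym (ℤ.pos-* G (suc m))))))
                       (ℤ.m-n≡m⊖n (H * suc n) (G * suc m))
    ∣numerator∣≤Z : ℤ.∣ numerator ∣ ≤ Z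
    ∣numerator∣≤Z = subst (_≤ Z) (sym (cong ℤ.∣_∣ numerator≡)) (∣⊖∣≤ Hn≤ Gm≤)
    cross-multiplied : + ℤ.∣ numerator ∣ ℤ.* + suc d ℤ.< ↥ ε ℤ.* + (suc m * suc n)
    cross-multiplied = subst (λ t → + ℤ.∣ numerator ∣ ℤ.* + suc d ℤ.< t ℤ.* + (suc m * suc n)) (sym ↥ε≡)
      (subst₂ ℤ._<_ (ℤ.pos-* ℤ.∣ numerator ∣ (suc d)) (ℤ.pos-* (suc num) (suc m * suc n))
        (ℤ.+<+ (ℕ.≤-<-trans (ℕ.*-monoˡ-≤ (suc d) ∣numerator∣≤Z) Zd<)))

  positive-numerator : ∀ ε → 0ℚ ℚ.< ε → ∃[ num ] ↥ ε ≡ + suc num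
  positive-numerator (mkℚ (+ zero) _ _) (ℚ.*<* (ℤ.+<+ ()))
  positive-numerator (mkℚ (+ suc n) _ _) _ = n , refl
  positive-numerator (mkℚ -[1+ n ] _ _) (ℚ.*<* ())

  -- After n = kM + r steps the error P · Bᵏ · qʳ is the fraction (B / q^M)ᵏ of P · qⁿ.
  geometric-convergence : ∀ (H : ℕ → ℕ) G P q M B .{{_ : NonZero M}} → 2 ≤ P → 0 < q → q ^ M ≡ B + P →
    (∀ k r → H (k * M + r) * P ≤ G * q ^ (k * M + r) + P * (B ^ k * q ^ r)
           × G * q ^ (k * M + r) ≤ H (k * M + r) * P + P * (B ^ k * q ^ r)) →
    (λ n → frac (H n) (q ^ n)) ⟶ frac G P
  geometric-convergence H G P q M B 2≤P 0<q qᴹ≡B+P bounds ε 0<ε with positive-numerator ε 0<ε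
  ... | num , ↥ε≡ = q ^ M * d * M , λ n N≤n →
    subst (λ m → ∣ frac (H m) (q ^ m) - frac G P ∣ ℚ.< ε) (sym (division n)) (close (n / M) (n % M) (quotient-large n N≤n))
    where
    d = ↧ₙ ε
    instance
      P≢0 : NonZero P
      P≢0 = ℕ.>-nonZero (ℕ.<-≤-trans (s≤s z≤n) 2≤P)
      q≢0 : NonZero q
      q≢0 = ℕ.>-nonZero 0<q
    division : ∀ n → n ≡ n / M * M + n % M
    division n = trans (m≡m%n+[m/n]*n n M) (ℕ.+-comm (n % M) _)
    quotient-large : ∀ n → q ^ M * d * M ≤ n → q ^ M * d ≤ n / M
    quotient-large n N≤n = ℕ.≤-trans (ℕ.≤-reflexive (sym (m*n/n≡m (q ^ M * d) M))) (/-monoˡ-≤ M N≤n)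
    close : ∀ k r → q ^ M * d ≤ k → ∣ frac (H (k * M + r)) (q ^ (k * M + r)) - frac G P ∣ ℚ.< ε
    close k r Qd≤k =
      ∣frac-frac∣< (H n) G (q ^ n) P Z ε num ↥ε≡ {{ℕ.m^n≢0 q n}} (proj₁ (bounds k r)) (proj₂ (bounds k r)) Zd<
      where
      open ℕ.≤-Reasoning
      n = k * M + r
      Z = P * (B ^ k * q ^ r)
      instance
        qʳP≢0 : NonZero (q ^ r * P)
        qʳP≢0 = ℕ.m*n≢0 (q ^ r) P {{ℕ.m^n≢0 q r}}
      qⁿ≡ : (q ^ M) ^ k * q ^ r ≡ q ^ n
      qⁿ≡ = trans (cong (_* q ^ r) (trans (ℕ.^-*-assoc q M k) (cong (q ^_) (ℕ.*-comm M k)))) (sym (ℕ.^-distribˡ-+-* q (k * M) r))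
      Zd< : Z * d < suc num * (q ^ n * P)
      Zd< = begin-strict
        Z * d                           ≡⟨ regroup P (B ^ k) (q ^ r) d ⟩
        (B ^ k * d) * (q ^ r * P)       <⟨ ℕ.*-monoˡ-< (q ^ r * P) (subst (λ Q → B ^ k * d < Q ^ k) (sym qᴹ≡B+P)
                                            (geometric-decay B P d k 2≤P (subst (λ Q → Q * d ≤ k) qᴹ≡B+P Qd≤k))) ⟩
        (q ^ M) ^ k * (q ^ r * P)       ≡⟨ trans (sym (ℕ.*-assoc ((q ^ M) ^ k) (q ^ r) P)) (cong (_* P) qⁿ≡) ⟩
        q ^ n * P                       ≤⟨ ℕ.m≤n*m (q ^ n * P) (suc num) ⟩
        suc num * (q ^ n * P)           ∎
        where
        regroup : ∀ P Bᵏ qʳ d → P * (Bᵏ * qʳ) * d ≡ (Bᵏ * d) * (qʳ * P)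
        regroup = ℕ-Solver.solve-∀

open Convergence

module RandomWalk (p : ℕ) .{{_ : NonZero p}} where

  open import Data.Nat using (_+_; _*_; _^_; _%_; _∸_)
  open Plane p
  open Congruence p using (_⊟_; ⊟-<; [a+c]%p⊟a≡c; [a+c⊟a]%p≡c)

  -- The step of Defs.walkSum, so that walkSum p (u ∷ t) reduces to u ⊕ walkSum p t.
  infixr 5 _⊕_
  _⊕_ : Pt → Pt → Pt
  (a , b) ⊕ (c , d) = (a + c) % p , (b + d) % p

  q : ℕ
  q = length (circle p 1)

  T : (Pt → ℕ) → Pt → ℕ
  T f x = ∑ (circle p 1) (λ u → f (u ⊕ x))

  T^ : ℕ → (Pt → ℕ) → Pt → ℕ
  T^ zero f = f
  T^ (suc n) f = T (T^ n f)

  T^-comm : ∀ n f → T^ n (T f) ≡ T (T^ n f)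
  T^-comm zero f = refl
  T^-comm (suc n) f = cong T (T^-comm n f)

  ∑-tuples : ∀ n f → ∑ (tuples p n) (f ∘ walkSum p) ≡ T^ n f (0 , 0)
  ∑-tuples zero f = ℕ.+-identityʳ (f (0 , 0))
  ∑-tuples (suc n) f = begin
    ∑ (concatMap (λ u → map (u ∷_) (tuples p n)) (circle p 1)) (f ∘ walkSum p)
      ≡⟨ ∑-concatMap (f ∘ walkSum p) (λ u → map (u ∷_) (tuples p n)) (circle p 1) ⟩
    ∑ (circle p 1) (λ u → ∑ (map (u ∷_) (tuples p n)) (f ∘ walkSum p))
      ≡⟨ ∑-cong {xs = circle p 1} (λ {u} _ → ∑-map (f ∘ walkSum p) (u ∷_) (tuples p n)) ⟩
    ∑ (circle p 1) (λ u → ∑ (tuples p n) (λ t → f (u ⊕ walkSum p t)))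
      ≡⟨ ∑-swap (λ u t → f (u ⊕ walkSum p t)) (circle p 1) (tuples p n) ⟩
    ∑ (tuples p n) (T f ∘ walkSum p)
      ≡⟨ ∑-tuples n (T f) ⟩
    T^ n (T f) (0 , 0)
      ≡⟨ cong (λ g → g (0 , 0)) (T^-comm n f) ⟩
    T^ (suc n) f (0 , 0) ∎
    where open ≡-Reasoning

  on-circle : ℕ → Pt → ℕ
  on-circle j x = indicator (norm p x ℕ.≟ j)

  on-circle≤1 : ∀ j x → on-circle j x ≤ 1
  on-circle≤1 j x with norm p x ℕ.≟ j
  ... | yes _ = ℕ.≤-refl
  ... | no _ = z≤n

  hits≡T^ : ∀ n j → hits p n j ≡ T^ n (on-circle j) (0 , 0)
  hits≡T^ n j = trans (length-filter (λ t → norm p (walkSum p t) ℕ.≟ j) (tuples p n)) (∑-tuples n (on-circle j))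

  ⊕-∈-points : ∀ u x → u ⊕ x ∈ points p
  ⊕-∈-points (a , b) (c , d) = ∈-points⁺ (m%n<n (a + c) p) (m%n<n (b + d) p)

  _≟ᵖ_ : (x y : Pt) → Dec (x ≡ y)
  _≟ᵖ_ = ≡-dec ℕ._≟_ ℕ._≟_

  kernel : ℕ → Pt → Pt → ℕ
  kernel zero x z = indicator (x ≟ᵖ z)
  kernel (suc n) x z = ∑ (circle p 1) (λ u → kernel n (u ⊕ x) z)

  T^-kernel : ∀ n f {x} → x ∈ points p → T^ n f x ≡ ∑ (points p) (λ z → kernel n x z * f z)
  T^-kernel zero f x∈ = sym (∑-indicator _≟ᵖ_ points-unique x∈)
  T^-kernel (suc n) f {x} x∈ = begin
    ∑ (circle p 1) (λ u → T^ n f (u ⊕ x))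
      ≡⟨ ∑-cong {xs = circle p 1} (λ {u} _ → T^-kernel n f (⊕-∈-points u x)) ⟩
    ∑ (circle p 1) (λ u → ∑ (points p) (λ z → kernel n (u ⊕ x) z * f z))
      ≡⟨ ∑-swap (λ u z → kernel n (u ⊕ x) z * f z) (circle p 1) (points p) ⟩
    ∑ (points p) (λ z → ∑ (circle p 1) (λ u → kernel n (u ⊕ x) z * f z))
      ≡⟨ ∑-cong {xs = points p} (λ {z} _ → ∑-*ʳ (f z) (λ u → kernel n (u ⊕ x) z) (circle p 1)) ⟩
    ∑ (points p) (λ z → kernel (suc n) x z * f z) ∎
    where open ≡-Reasoning

  T^-const : ∀ n c x → T^ n (λ _ → c) x ≡ q ^ n * c
  T^-const zero c x = sym (ℕ.*-identityˡ c)
  T^-const (suc n) c x = begin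
    ∑ (circle p 1) (λ u → T^ n (λ _ → c) (u ⊕ x))  ≡⟨ ∑-cong {xs = circle p 1} (λ {u} _ → T^-const n c (u ⊕ x)) ⟩
    ∑ (circle p 1) (λ _ → q ^ n * c)                ≡⟨ ∑-const (q ^ n * c) (circle p 1) ⟩
    q * (q ^ n * c)                                 ≡⟨ sym (ℕ.*-assoc q (q ^ n) c) ⟩
    q ^ suc n * c                                   ∎
    where open ≡-Reasoning

  kernel-row-sum : ∀ n {x} → x ∈ points p → ∑ (points p) (kernel n x) ≡ q ^ n
  kernel-row-sum n {x} x∈ = begin
    ∑ (points p) (kernel n x)                        ≡⟨ ∑-cong {xs = points p} (λ {z} _ → sym (ℕ.*-identityʳ (kernel n x z))) ⟩
    ∑ (points p) (λ z → kernel n x z * 1)            ≡⟨ sym (T^-kernel n (λ _ → 1) x∈) ⟩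
    T^ n (λ _ → 1) x                            ≡⟨ T^-const n 1 x ⟩
    q ^ n * 1                                   ≡⟨ ℕ.*-identityʳ (q ^ n) ⟩
    q ^ n                                       ∎
    where open ≡-Reasoning

  ∑-translate : ∀ (f : Pt → ℕ) u → ∑ (points p) (λ x → f (u ⊕ x)) ≡ ∑ (points p) f
  ∑-translate f (a , b) = ∑-bijection (λ { (c , d) → c ⊟ a , d ⊟ b }) points-unique points-unique
    (λ {x} _ → ⊕-∈-points (a , b) x)
    (λ { {c , d} _ → ∈-points⁺ (⊟-< c a) (⊟-< d b) })
    (λ { {c , d} x∈ → cong₂ _,_ ([a+c]%p⊟a≡c a (proj₁ (∈-points⁻ x∈))) ([a+c]%p⊟a≡c b (proj₂ (∈-points⁻ x∈))) })
    (λ { {c , d} x∈ → cong₂ _,_ ([a+c⊟a]%p≡c a (proj₁ (∈-points⁻ x∈))) ([a+c⊟a]%p≡c b (proj₂ (∈-points⁻ x∈))) })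

  ∑-T : ∀ f → ∑ (points p) (T f) ≡ q * ∑ (points p) f
  ∑-T f = begin
    ∑ (points p) (λ x → ∑ (circle p 1) (λ u → f (u ⊕ x)))   ≡⟨ ∑-swap (λ x u → f (u ⊕ x)) (points p) (circle p 1) ⟩
    ∑ (circle p 1) (λ u → ∑ (points p) (λ x → f (u ⊕ x)))   ≡⟨ ∑-cong {xs = circle p 1} (λ {u} _ → ∑-translate f u) ⟩
    ∑ (circle p 1) (λ _ → ∑ (points p) f)                   ≡⟨ ∑-const (∑ (points p) f) (circle p 1) ⟩
    q * ∑ (points p) f                                      ∎
    where open ≡-Reasoning

  ∑-T^ : ∀ n f → ∑ (points p) (T^ n f) ≡ q ^ n * ∑ (points p) f
  ∑-T^ zero f = sym (ℕ.*-identityˡ _)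
  ∑-T^ (suc n) f = trans (∑-T (T^ n f)) (trans (cong (q *_) (∑-T^ n f)) (sym (ℕ.*-assoc q (q ^ n) _)))

  T^-+ : ∀ m n f → T^ (m + n) f ≡ T^ m (T^ n f)
  T^-+ zero n f = refl
  T^-+ (suc m) n f = cong T (T^-+ m n f)

  module Doeblin (M : ℕ) (positive : ∀ {x z} → x ∈ points p → z ∈ points p → 1 ≤ kernel M x z) where

    Q : ℕ
    Q = q ^ M

    B : ℕ
    B = Q ∸ p * p

    Band : (Pt → ℕ) → ℕ → ℕ → Set
    Band f a D = ∀ {z} → z ∈ points p → a ≤ f z × f z ≤ a + D

    ∑-points-const : ∀ c → ∑ (points p) (λ _ → c) ≡ p * p * c
    ∑-points-const c = trans (∑-const c (points p)) (cong (_* c) length-points)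

    p²≤Q : p * p ≤ Q
    p²≤Q = begin
      p * p                           ≡⟨ sym (trans (∑-points-const 1) (ℕ.*-identityʳ (p * p))) ⟩
      ∑ (points p) (λ _ → 1)          ≤⟨ ∑-mono (positive origin∈) ⟩
      ∑ (points p) (kernel M (0 , 0))      ≡⟨ kernel-row-sum M origin∈ ⟩
      Q                               ∎
      where open ℕ.≤-Reasoning

    Q≡B+p² : Q ≡ B + p * p
    Q≡B+p² = sym (ℕ.m∸n+n≡m p²≤Q)

    T^-band : ∀ n {f a D} → Band f a D → Band (T^ n f) (q ^ n * a) (q ^ n * D)
    T^-band n {f} {a} {D} band {x} x∈ = lower , upper
      where
      open ℕ.≤-Reasoning
      lower : q ^ n * a ≤ T^ n f x
      lower = begin
        q ^ n * a                               ≡⟨ cong (_* a) (sym (kernel-row-sum n x∈)) ⟩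
        ∑ (points p) (kernel n x) * a                ≡⟨ sym (∑-*ʳ a (kernel n x) (points p)) ⟩
        ∑ (points p) (λ z → kernel n x z * a)        ≤⟨ ∑-mono (λ {z} z∈ → ℕ.*-monoʳ-≤ (kernel n x z) (proj₁ (band z∈))) ⟩
        ∑ (points p) (λ z → kernel n x z * f z)      ≡⟨ sym (T^-kernel n f x∈) ⟩
        T^ n f x                                ∎
      upper : T^ n f x ≤ q ^ n * a + q ^ n * D
      upper = begin
        T^ n f x                                ≡⟨ T^-kernel n f x∈ ⟩
        ∑ (points p) (λ z → kernel n x z * f z)      ≤⟨ ∑-mono (λ {z} z∈ → ℕ.*-monoʳ-≤ (kernel n x z) (proj₂ (band z∈))) ⟩
        ∑ (points p) (λ z → kernel n x z * (a + D))  ≡⟨ ∑-*ʳ (a + D) (kernel n x) (points p) ⟩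
        ∑ (points p) (kernel n x) * (a + D)          ≡⟨ cong (_* (a + D)) (kernel-row-sum n x∈) ⟩
        q ^ n * (a + D)                         ≡⟨ ℕ.*-distribˡ-+ (q ^ n) a D ⟩
        q ^ n * a + q ^ n * D                   ∎

    -- Writing the M-step kernel as 1 + E, where E has total mass B, the band width shrinks from D to B · D.
    contraction : ∀ {f a D} → Band f a D → Band (T^ M f) (∑ (points p) f + B * a) (B * D)
    contraction {f} {a} {D} band {x} x∈ = lower , upper
      where
      open ℕ.≤-Reasoning
      E : Pt → ℕ
      E z = kernel M x z ∸ 1
      kernel≡1+E : ∀ {z} → z ∈ points p → kernel M x z ≡ 1 + E z
      kernel≡1+E z∈ = sym (ℕ.m+[n∸m]≡n (positive x∈ z∈))
      ∑E≡B : ∑ (points p) E ≡ B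
      ∑E≡B = sym (begin-equality
        Q ∸ p * p                                   ≡⟨ cong (_∸ p * p) (sym (kernel-row-sum M x∈)) ⟩
        ∑ (points p) (kernel M x) ∸ p * p                ≡⟨ cong (_∸ p * p) (∑-cong kernel≡1+E) ⟩
        ∑ (points p) (λ z → 1 + E z) ∸ p * p        ≡⟨ cong (_∸ p * p) (∑-+ (points p)) ⟩
        ∑ (points p) (λ _ → 1) + ∑ (points p) E ∸ p * p
                                                    ≡⟨ cong (λ t → t + ∑ (points p) E ∸ p * p) (trans (∑-points-const 1) (ℕ.*-identityʳ (p * p))) ⟩
        p * p + ∑ (points p) E ∸ p * p              ≡⟨ ℕ.m+n∸m≡n (p * p) _ ⟩
        ∑ (points p) E                              ∎)
      split : T^ M f x ≡ ∑ (points p) f + ∑ (points p) (λ z → E z * f z)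
      split = begin-equality
        T^ M f x                                        ≡⟨ T^-kernel M f x∈ ⟩
        ∑ (points p) (λ z → kernel M x z * f z)              ≡⟨ ∑-cong (λ z∈ → cong (_* f _) (kernel≡1+E z∈)) ⟩
        ∑ (points p) (λ z → f z + E z * f z)            ≡⟨ ∑-+ (points p) ⟩
        ∑ (points p) f + ∑ (points p) (λ z → E z * f z) ∎
      lower : ∑ (points p) f + B * a ≤ T^ M f x
      lower = begin
        ∑ (points p) f + B * a                          ≡⟨ cong (λ t → ∑ (points p) f + t * a) (sym ∑E≡B) ⟩
        ∑ (points p) f + ∑ (points p) E * a             ≡⟨ cong (λ t → ∑ (points p) f + t) (sym (∑-*ʳ a E (points p))) ⟩
        ∑ (points p) f + ∑ (points p) (λ z → E z * a)   ≤⟨ ℕ.+-monoʳ-≤ (∑ (points p) f) (∑-mono (λ {z} z∈ → ℕ.*-monoʳ-≤ (E z) (proj₁ (band z∈)))) ⟩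
        ∑ (points p) f + ∑ (points p) (λ z → E z * f z) ≡⟨ sym split ⟩
        T^ M f x                                        ∎
      upper : T^ M f x ≤ ∑ (points p) f + B * a + B * D
      upper = begin
        T^ M f x                                          ≡⟨ split ⟩
        ∑ (points p) f + ∑ (points p) (λ z → E z * f z)   ≤⟨ ℕ.+-monoʳ-≤ (∑ (points p) f) (∑-mono (λ {z} z∈ → ℕ.*-monoʳ-≤ (E z) (proj₂ (band z∈)))) ⟩
        ∑ (points p) f + ∑ (points p) (λ z → E z * (a + D))
                                                          ≡⟨ cong (λ t → ∑ (points p) f + t) (trans (∑-*ʳ (a + D) E (points p)) (cong (_* (a + D)) ∑E≡B)) ⟩
        ∑ (points p) f + B * (a + D)                      ≡⟨ cong (λ t → ∑ (points p) f + t) (ℕ.*-distribˡ-+ B a D) ⟩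
        ∑ (points p) f + (B * a + B * D)                  ≡⟨ sym (ℕ.+-assoc (∑ (points p) f) (B * a) (B * D)) ⟩
        ∑ (points p) f + B * a + B * D                    ∎

    band-iterate : ∀ {f} → (∀ z → f z ≤ 1) → ∀ k r → ∃[ a ] Band (T^ (k * M + r) f) a (B ^ k * q ^ r)
    band-iterate {f} f≤1 zero r =
      q ^ r * 0 , subst (Band (T^ r f) (q ^ r * 0)) (trans (ℕ.*-identityʳ (q ^ r)) (sym (ℕ.*-identityˡ (q ^ r))))
                    (T^-band r (λ {z} _ → z≤n , f≤1 z))
    band-iterate {f} f≤1 (suc k) r =
      let a , band = band-iterate f≤1 k r
      in ∑ (points p) (T^ (k * M + r) f) + B * a ,
         subst₂ (λ g → Band g (∑ (points p) (T^ (k * M + r) f) + B * a))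
           (sym (trans (cong (λ n → T^ n f) (ℕ.+-assoc M (k * M) r)) (T^-+ M (k * M + r) f)))
           (sym (ℕ.*-assoc B (B ^ k) (q ^ r)))
           (contraction band)

    estimate : ∀ {f} → (∀ z → f z ≤ 1) → ∀ k r →
               let n = k * M + r ; H = T^ n f (0 , 0) ; G = ∑ (points p) f ; Z = p * p * (B ^ k * q ^ r) in
               H * (p * p) ≤ G * q ^ n + Z × G * q ^ n ≤ H * (p * p) + Z
    estimate {f} f≤1 k r = above , below
      where
      open ℕ.≤-Reasoning
      n = k * M + r
      H = T^ n f (0 , 0)
      G = ∑ (points p) f
      D = B ^ k * q ^ r
      P = p * p
      a = proj₁ (band-iterate f≤1 k r)
      band : Band (T^ n f) a D
      band = proj₂ (band-iterate f≤1 k r)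
      ∑≡ : ∑ (points p) (T^ n f) ≡ G * q ^ n
      ∑≡ = trans (∑-T^ n f) (ℕ.*-comm (q ^ n) G)
      ∑≥ : P * a ≤ ∑ (points p) (T^ n f)
      ∑≥ = ℕ.≤-trans (ℕ.≤-reflexive (sym (∑-points-const a))) (∑-mono (proj₁ ∘ band))
      ∑≤ : ∑ (points p) (T^ n f) ≤ P * a + P * D
      ∑≤ = ℕ.≤-trans (∑-mono (proj₂ ∘ band)) (ℕ.≤-reflexive (trans (∑-points-const (a + D)) (ℕ.*-distribˡ-+ P a D)))
      above : H * P ≤ G * q ^ n + P * D
      above = begin
        H * P                     ≤⟨ ℕ.*-monoˡ-≤ P (proj₂ (band origin∈)) ⟩
        (a + D) * P               ≡⟨ trans (ℕ.*-comm (a + D) P) (ℕ.*-distribˡ-+ P a D) ⟩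
        P * a + P * D             ≤⟨ ℕ.+-monoˡ-≤ (P * D) ∑≥ ⟩
        ∑ (points p) (T^ n f) + P * D   ≡⟨ cong (_+ P * D) ∑≡ ⟩
        G * q ^ n + P * D         ∎
      below : G * q ^ n ≤ H * P + P * D
      below = begin
        G * q ^ n                 ≡⟨ sym ∑≡ ⟩
        ∑ (points p) (T^ n f)     ≤⟨ ∑≤ ⟩
        P * a + P * D             ≤⟨ ℕ.+-monoˡ-≤ (P * D) (ℕ.*-monoʳ-≤ P (proj₁ (band origin∈))) ⟩
        P * H + P * D             ≡⟨ cong (_+ P * D) (ℕ.*-comm P H) ⟩
        H * P + P * D             ∎

  data Walk : ℕ → Pt → Pt → Set where
    []  : ∀ {x} → Walk 0 x x
    _∷_ : ∀ {n u x y} → u ∈ circle p 1 → Walk n (u ⊕ x) y → Walk (suc n) x y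

  _++ʷ_ : ∀ {m n x y z} → Walk m x y → Walk n y z → Walk (m + n) x z
  [] ++ʷ w = w
  (u∈ ∷ v) ++ʷ w = u∈ ∷ (v ++ʷ w)

  kernel-walk : ∀ {n x y} → Walk n x y → ∀ m z → kernel m y z ≤ kernel (n + m) x z
  kernel-walk [] m z = ℕ.≤-refl
  kernel-walk {suc n} {x} (_∷_ {u = u} u∈ w) m z =
    ℕ.≤-trans (kernel-walk w m z) (∑-single {f = λ v → kernel (n + m) (v ⊕ x) z} u∈)

  kernel-positive : ∀ {n x z} → Walk n x z → 1 ≤ kernel n x z
  kernel-positive {n} {x} {z} w = subst₂ _≤_ kernel-diagonal (cong (λ k → kernel k x z) (ℕ.+-identityʳ n)) (kernel-walk w 0 z)
    where
    kernel-diagonal : kernel 0 z z ≡ 1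
    kernel-diagonal with z ≟ᵖ z
    ... | yes _ = refl
    ... | no z≢z = ⊥-elim (z≢z refl)

  walk-line : ∀ {s t} → (s , t) ∈ circle p 1 → ∀ k {a b} → a < p → b < p →
              Walk k (a , b) ((a + k * s) % p , (b + k * t) % p)
  walk-line {s} {t} u∈ zero {a} {b} a<p b<p =
    subst (Walk 0 (a , b)) (sym (cong₂ _,_ (stay a<p) (stay b<p))) []
    where
    stay : ∀ {c} → c < p → (c + 0) % p ≡ c
    stay {c} c<p = trans (cong (_% p) (ℕ.+-identityʳ c)) (m<n⇒m%n≡m c<p)
  walk-line {s} {t} u∈ (suc k) {a} {b} a<p b<p =
    subst (Walk (suc k) (a , b)) (cong₂ _,_ (step s a) (step t b))
      (u∈ ∷ walk-line u∈ k (m%n<n (s + a) p) (m%n<n (t + b) p))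
    where
    step : ∀ s a → ((s + a) % p + k * s) % p ≡ (a + suc k * s) % p
    step s a = trans ([m%n+o]%n≡[m+o]%n (s + a) p (k * s)) (cong (_% p) (identity s a k))
      where
      identity : ∀ s a k → s + a + k * s ≡ a + (s + k * s)
      identity = ℕ-Solver.solve-∀

  module _ (h : ℕ) (p≡2h+1 : p ≡ suc (h + h)) (1<p : 1 < p) where

    private
      0<p : 0 < p
      0<p = ℕ.<-trans ℕ.z<s 1<p

      e₁∈ : (1 , 0) ∈ circle p 1
      e₁∈ = ∈-circle⁺ (∈-points⁺ 1<p 0<p) (m<n⇒m%n≡m 1<p)

      e₂∈ : (0 , 1) ∈ circle p 1
      e₂∈ = ∈-circle⁺ (∈-points⁺ 0<p 1<p) (m<n⇒m%n≡m 1<p)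

      -e₁∈ : (p ∸ 1 , 0) ∈ circle p 1
      -e₁∈ = ∈-circle⁺ (∈-points⁺ (ℕ.∸-monoʳ-< ℕ.z<s 0<p) 0<p) (norm-1 p 1<p)
        where
        norm-1 : ∀ m .{{_ : NonZero m}} → 1 < m → ((m ∸ 1) * (m ∸ 1) + 0 * 0) % m ≡ 1
        norm-1 (suc zero) (s≤s ())
        norm-1 (suc (suc r)) _ = trans (cong (_% suc (suc r)) (identity r)) ([m+kn]%n≡m%n 1 r (suc (suc r)))
          where
          identity : ∀ r → suc r * suc r + 0 ≡ 1 + r * suc (suc r)
          identity = ℕ-Solver.solve-∀

      unmoved : ∀ k {c} → c < p → (c + k * 0) % p ≡ c
      unmoved k {c} c<p =
        trans (cong (λ t → (c + t) % p) (ℕ.*-zeroʳ k)) (trans (cong (_% p) (ℕ.+-identityʳ c)) (m<n⇒m%n≡m c<p))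

      arrive : ∀ {a c} → a ≤ p → c < p → (a + (p ∸ a + c) * 1) % p ≡ c
      arrive {a} {c} a≤p c<p = begin
        (a + (p ∸ a + c) * 1) % p    ≡⟨ cong (λ t → (a + t) % p) (ℕ.*-identityʳ (p ∸ a + c)) ⟩
        (a + (p ∸ a + c)) % p        ≡⟨ cong (_% p) (sym (ℕ.+-assoc a (p ∸ a) c)) ⟩
        (a + (p ∸ a) + c) % p        ≡⟨ cong (λ t → (t + c) % p) (ℕ.m+[n∸m]≡n a≤p) ⟩
        (p + c) % p                  ≡⟨ cong (_% p) (ℕ.+-comm p c) ⟩
        (c + p) % p                  ≡⟨ [m+n]%n≡m%n c p ⟩
        c % p                        ≡⟨ m<n⇒m%n≡m c<p ⟩
        c                            ∎
        where open ≡-Reasoning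

    walk-loop : ∀ {a b} → a < p → b < p → Walk p (a , b) (a , b)
    walk-loop {a} {b} a<p b<p =
      subst (Walk p (a , b)) (cong₂ _,_ arrive-at-start (unmoved p b<p)) (walk-line e₁∈ p a<p b<p)
      where
      arrive-at-start : (a + p * 1) % p ≡ a
      arrive-at-start = trans (cong (λ t → (a + t) % p) (ℕ.*-identityʳ p)) (trans ([m+n]%n≡m%n a p) (m<n⇒m%n≡m a<p))

    walk-there-and-back : ∀ {a b} → a < p → b < p → Walk 2 (a , b) (a , b)
    walk-there-and-back {a} {b} a<p b<p =
      subst (Walk 2 (a , b)) (cong₂ _,_ back (trans (m%n%n≡m%n b p) (m<n⇒m%n≡m b<p))) (e₁∈ ∷ (-e₁∈ ∷ []))
      where
      back : (p ∸ 1 + (1 + a) % p) % p ≡ a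
      back = begin
        (p ∸ 1 + (1 + a) % p) % p    ≡⟨ cong (_% p) (ℕ.+-comm (p ∸ 1) _) ⟩
        ((1 + a) % p + (p ∸ 1)) % p  ≡⟨ [m%n+o]%n≡[m+o]%n (1 + a) p (p ∸ 1) ⟩
        (1 + a + (p ∸ 1)) % p        ≡⟨ cong (_% p) (identity a (p ∸ 1)) ⟩
        (a + (1 + (p ∸ 1))) % p      ≡⟨ cong (λ t → (a + t) % p) (ℕ.m+[n∸m]≡n {1} (ℕ.<⇒≤ 1<p)) ⟩
        (a + p) % p                  ≡⟨ [m+n]%n≡m%n a p ⟩
        a % p                        ≡⟨ m<n⇒m%n≡m a<p ⟩
        a                            ∎
        where
        open ≡-Reasoning
        identity : ∀ a r → 1 + a + r ≡ a + (1 + r)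
        identity = ℕ-Solver.solve-∀

    walk-pairs : ∀ j {a b} → a < p → b < p → Walk (j * 2) (a , b) (a , b)
    walk-pairs zero a<p b<p = []
    walk-pairs (suc j) a<p b<p = walk-there-and-back a<p b<p ++ʷ walk-pairs j a<p b<p

    -- An odd waiting time is spent on one loop of p steps along (1,0) and back-and-forth pairs.
    walk-wait : ∀ E {a b} → p ≤ E → a < p → b < p → Walk E (a , b) (a , b)
    walk-wait E {a} {b} p≤E a<p b<p with even-or-odd E
    ... | inj₁ (j , refl) = walk-pairs j a<p b<p
    ... | inj₂ (j , refl) = subst (λ n → Walk n (a , b) (a , b)) E≡ (walk-loop a<p b<p ++ʷ walk-pairs (j ∸ h) a<p b<p)
      where
      h≤j : h ≤ j
      h≤j = ℕ.*-cancelʳ-≤ h j 2 (subst (_≤ j * 2) (identity₁ h) (ℕ.≤-pred (subst (_≤ suc (j * 2)) p≡2h+1 p≤E)))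
        where
        identity₁ : ∀ h → h + h ≡ h * 2
        identity₁ = ℕ-Solver.solve-∀
      E≡ : p + (j ∸ h) * 2 ≡ suc (j * 2)
      E≡ = begin
        p + (j ∸ h) * 2              ≡⟨ cong (_+ (j ∸ h) * 2) p≡2h+1 ⟩
        suc (h + h) + (j ∸ h) * 2    ≡⟨ identity₂ h (j ∸ h) ⟩
        suc ((h + (j ∸ h)) * 2)      ≡⟨ cong (λ t → suc (t * 2)) (ℕ.m+[n∸m]≡n h≤j) ⟩
        suc (j * 2)                  ∎
        where
        open ≡-Reasoning
        identity₂ : ∀ h d → suc (h + h) + d * 2 ≡ suc ((h + d) * 2)
        identity₂ = ℕ-Solver.solve-∀

    -- Both legs take fewer than 2p steps, which leaves at least p of the 5p steps for waiting at z.
    walk-between : ∀ {x z} → x ∈ points p → z ∈ points p → Walk (5 * p) x z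
    walk-between {a , b} {c , d} x∈ z∈ =
      subst (λ n → Walk n (a , b) (c , d)) total (along-e₁ ++ʷ (along-e₂ ++ʷ walk-wait E p≤E c<p d<p))
      where
      a<p : a < p
      a<p = proj₁ (∈-points⁻ x∈)
      b<p : b < p
      b<p = proj₂ (∈-points⁻ x∈)
      c<p : c < p
      c<p = proj₁ (∈-points⁻ z∈)
      d<p : d < p
      d<p = proj₂ (∈-points⁻ z∈)
      d₁ = p ∸ a + c
      d₂ = p ∸ b + d
      along-e₁ : Walk d₁ (a , b) (c , b)
      along-e₁ =
        subst (Walk d₁ (a , b)) (cong₂ _,_ (arrive (ℕ.<⇒≤ a<p) c<p) (unmoved d₁ b<p)) (walk-line e₁∈ d₁ a<p b<p)
      along-e₂ : Walk d₂ (c , b) (c , d)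
      along-e₂ =
        subst (Walk d₂ (c , b)) (cong₂ _,_ (unmoved d₂ c<p) (arrive (ℕ.<⇒≤ b<p) d<p)) (walk-line e₂∈ d₂ c<p b<p)
      D≤ : d₁ + d₂ ≤ (p + p) + (p + p)
      D≤ = ℕ.+-mono-≤ (ℕ.+-mono-≤ (ℕ.m∸n≤m p a) (ℕ.<⇒≤ c<p)) (ℕ.+-mono-≤ (ℕ.m∸n≤m p b) (ℕ.<⇒≤ d<p))
      five : p + ((p + p) + (p + p)) ≡ 5 * p
      five = identity p
        where
        identity : ∀ p → p + ((p + p) + (p + p)) ≡ 5 * p
        identity = ℕ-Solver.solve-∀
      E = 5 * p ∸ (d₁ + d₂)
      p≤E : p ≤ E
      p≤E = ℕ.m+n≤o⇒m≤o∸n p (ℕ.≤-trans (ℕ.+-monoʳ-≤ p D≤) (ℕ.≤-reflexive five))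
      total : d₁ + (d₂ + E) ≡ 5 * p
      total = trans (sym (ℕ.+-assoc d₁ d₂ E))
        (ℕ.m+[n∸m]≡n (ℕ.≤-trans D≤ (ℕ.≤-trans (ℕ.m≤n+m _ p) (ℕ.≤-reflexive five))))

    kernel-positive-after : ∀ {x z} → x ∈ points p → z ∈ points p → 1 ≤ kernel (5 * p) x z
    kernel-positive-after x∈ z∈ = kernel-positive (walk-between x∈ z∈)

    open Doeblin (5 * p) kernel-positive-after

    α-converges : ∀ j → (λ n → α p n j) ⟶ frac (length (circle p j)) (p * p)
    α-converges j = subst (λ G → (λ n → α p n j) ⟶ frac G (p * p)) (sym (length-filter _ (points p)))
      (geometric-convergence (λ n → hits p n j) (∑ (points p) (on-circle j)) (p * p) q (5 * p) B {{ℕ.m*n≢0 5 p}}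
        (ℕ.≤-trans 1<p (ℕ.m≤m*n p p)) (∈-length e₁∈) Q≡B+p² hits-estimate)
      where
      hits-estimate : ∀ k r → let n = k * (5 * p) + r ; G = ∑ (points p) (on-circle j) ; Z = p * p * (B ^ k * q ^ r) in
                      hits p n j * (p * p) ≤ G * q ^ n + Z × G * q ^ n ≤ hits p n j * (p * p) + Z
      hits-estimate k r rewrite hits≡T^ (k * (5 * p) + r) j = estimate (on-circle≤1 j) k r

open import Data.Nat using (_*_; _+_; _%_)

theorem4 : (p : ℕ) .{{_ : NonZero p}} → Prime p → p % 4 ≡ 3 →
    ((λ n → α p n 0) ⟶ frac 1 (p * p))
    × (∀ (j : ℕ) → 1 ≤ j → j < p → ((λ n → α p n j) ⟶ frac (p + 1) (p * p)))
theorem4 p p-prime p%4≡3 =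
  limit 0 1 circle-0-length , λ j 1≤j j<p → limit j (p + 1) (trans (circle-length 1≤j j<p) (ℕ.+-comm 1 p))
  where
  open CircleSizes p p-prime p%4≡3 using (circle-0-length; circle-length)
  odd : ∃[ h ] p ≡ suc (h + h)
  odd = %4≡3⇒odd {p} p%4≡3
  limit : ∀ j G → length (circle p j) ≡ G → (λ n → α p n j) ⟶ frac G (p * p)
  limit j G |Cⱼ|≡G = subst (λ G → (λ n → α p n j) ⟶ frac G (p * p)) |Cⱼ|≡G
    (RandomWalk.α-converges p (proj₁ odd) (proj₂ odd) (PrimeField.1<p p p-prime) j)
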